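{- Let $n\ge 2$, $m\ge 0$, $l\ge 0$ be integers, let $s_1,\dots,s_n$ be mutually distinct positive integers, and set $$Q=\int_{x_{s_1}}^{x_{s_2}}t^l\prod_{i=1}^n(t-x_{s_i})^m\,dt\in\mathbb{Q}[x_{s_1},\dots,x_{s_n}].$$ Then $Q$ is a homogeneous polynomial of degree $nm+l+1$ and: (1) $Q$ is symmetric in $x_{s_3},\dots,x_{s_n}$ and anti-symmetric in $x_{s_1},x_{s_2}$; (2) the degree of $Q$ as a polynomial in $x_{s_1}$ is $nm+l+1$, with leading coefficient $\frac{(-1)^{m+1}m!}{\prod_{s=0}^m(mn+l+1-s)}$; (3) for each $i\in\{3,\dots,n\}$, the degree of $Q$ as a polynomial in $x_{s_i}$ is $m$, with leading coefficient $(-1)^m\int_{x_{s_1}}^{x_{s_2}}t^l\prod_{j\ne i}(t-x_{s_j})^m\,dt$. -}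

module Defs where

open import Data.Nat as ℕ using (ℕ; zero; suc; _<_)
open import Data.Nat using (_!)
open import Data.Integer as ℤ using (ℤ; +_)
open import Data.Rational as ℚ using (ℚ; 0ℚ; 1ℚ)
open import Data.Rational.Properties using () renaming (_≟_ to _≟ℚ_)
open import Data.Fin using (Fin) renaming (zero to fzero; suc to fsuc; _≟_ to _≟F_)
open import Data.Fin.Permutation using (Permutation′; _⟨$⟩ʳ_; _⟨$⟩ˡ_)
open import Data.Vec as Vec using (Vec; _∷_; lookup; tabulate; replicate; zipWith; updateAt)
open import Data.Vec.Properties using (≡-dec)
open import Data.List as List using (List; []; _∷_; _++_; concatMap; foldr; allFin; filterᵇ)
open import Data.Product using (_×_; _,_)
open import Data.Bool using (Bool; true; false; if_then_else_; not)
open import Relation.Nullary using (¬_; yes; no; does)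
open import Relation.Binary.PropositionalEquality using (_≡_)

-- Multivariate polynomials over ℚ in n variables x₀ … x_{n-1}
-- represented as formal (unnormalised) sums of terms c · x^e ;
-- equality is equality of all coefficients.

Exp : ℕ → Set
Exp n = Vec ℕ n

Poly : ℕ → Set
Poly n = List (ℚ × Exp n)

coeff : ∀ {n} → Poly n → Exp n → ℚ
coeff [] e = 0ℚ
coeff ((c , e′) ∷ p) e with ≡-dec ℕ._≟_ e′ e
... | yes _ = c ℚ.+ coeff p e
... | no  _ = coeff p e

infix 4 _≈_
_≈_ : ∀ {n} → Poly n → Poly n → Set
p ≈ q = ∀ e → coeff p e ≡ coeff q e

0P : ∀ {n} → Poly n
0P = []

const : ∀ {n} → ℚ → Poly n
const c = (c , replicate _ 0) ∷ []

var : ∀ {n} → Fin n → Poly n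
var i = (1ℚ , tabulate (λ j → if does (i ≟F j) then 1 else 0)) ∷ []

infixl 6 _+P_ _-P_
infixl 7 _*P_
infixr 8 _^P_

_+P_ : ∀ {n} → Poly n → Poly n → Poly n
_+P_ = _++_

-P_ : ∀ {n} → Poly n → Poly n
-P_ = List.map (λ { (c , e) → (ℚ.- c , e) })

_-P_ : ∀ {n} → Poly n → Poly n → Poly n
p -P q = p +P (-P q)

_*P_ : ∀ {n} → Poly n → Poly n → Poly n
p *P q = concatMap (λ { (c , e) → List.map (λ { (d , f) → (c ℚ.* d , zipWith ℕ._+_ e f) }) q }) p

_^P_ : ∀ {n} → Poly n → ℕ → Poly n
p ^P zero  = const 1ℚ
p ^P suc k = p *P (p ^P k)

prodP : ∀ {n} → List (Poly n) → Poly n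
prodP = foldr _*P_ (const 1ℚ)

-- q / d  for a natural number d (only ever used with d ≠ 0; the value
-- at d = 0 is irrelevant).
_÷ℕ_ : ℚ → ℕ → ℚ
q ÷ℕ zero  = 0ℚ
q ÷ℕ suc d = q ℚ.* ((+ 1) ℚ./ suc d)

ℤ→ℚ : ℤ → ℚ
ℤ→ℚ z = z ℚ./ 1

prodℕ : List ℕ → ℕ
prodℕ = foldr ℕ._*_ 1

-- A polynomial in Poly (suc n) is a polynomial in t (variable 0) and
-- x₀ … x_{n-1} (variables 1 … n).  ∫_{x_a}^{x_b} p dt ∈ Poly n, computed
-- termwise: ∫ c t^k x^e dt = c/(k+1) (x_b^{k+1} - x_a^{k+1}) x^e.

addAt : ∀ {n} → Fin n → ℕ → Exp n → Exp n
addAt i k e = updateAt e i (ℕ._+ k)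

integral : ∀ {n} → Fin n → Fin n → Poly (suc n) → Poly n
integral a b = concatMap (λ { (c , k ∷ e) →
  (c ÷ℕ suc k , addAt b (suc k) e) ∷ (ℚ.- (c ÷ℕ suc k) , addAt a (suc k) e) ∷ [] })

T : ∀ {n} → Poly (suc n)
T = var fzero

X : ∀ {n} → Fin n → Poly (suc n)
X i = var (fsuc i)

integrand : ∀ {n} → ℕ → ℕ → List (Fin n) → Poly (suc n)
integrand l m J = (T ^P l) *P prodP (List.map (λ j → (T -P X j) ^P m) J)

-- renaming of variables along a permutation σ (x_i ↦ x_{σ i})
rename : ∀ {n} → Permutation′ n → Poly n → Poly n
rename σ = List.map (λ { (c , e) → (c , tabulate (λ j → lookup e (σ ⟨$⟩ˡ j))) })

sumℕ : ∀ {n} → Vec ℕ n → ℕ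
sumℕ = Vec.foldr _ ℕ._+_ 0

IsHomogeneousOfDegree : ∀ {n} → ℕ → Poly n → Set
IsHomogeneousOfDegree d p = ¬ (p ≈ 0P) × (∀ e → ¬ (coeff p e ≡ 0ℚ) → sumℕ e ≡ d)

coeffIn : ∀ {n} → Fin n → ℕ → Poly n → Poly n
coeffIn i d = concatMap (λ { (c , e) →
  if does (lookup e i ℕ.≟ d) then (c , updateAt e i (λ _ → 0)) ∷ [] else [] })

DegreeIn : ∀ {n} → Fin n → ℕ → Poly n → Set
DegreeIn i d p = ¬ (coeffIn i d p ≈ 0P) × (∀ k → d < k → coeffIn i k p ≈ 0P)

-- The polynomial Q of Proposition 3, with n = 2 + k variables
-- x_{s_1}, …, x_{s_n} named by indices 0, …, n-1.

i₁ i₂ : ∀ {k} → Fin (2 ℕ.+ k)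
i₁ = fzero
i₂ = fsuc fzero

Q : (k m l : ℕ) → Poly (2 ℕ.+ k)
Q k m l = integral i₁ i₂ (integrand l m (allFin (2 ℕ.+ k)))

Qexcept : (k m l : ℕ) → Fin (2 ℕ.+ k) → Poly (2 ℕ.+ k)
Qexcept k m l i = integral i₁ i₂
  (integrand l m (filterᵇ (λ j → not (does (j ≟F i))) (allFin (2 ℕ.+ k))))

leadCoeff₁ : (n m l : ℕ) → ℚ
leadCoeff₁ n m l = ℤ→ℚ ((ℤ.- (+ 1)) ℤ.^ suc m ℤ.* (+ (m !)))
  ÷ℕ prodℕ (List.map (λ s → m ℕ.* n ℕ.+ l ℕ.+ 1 ℕ.∸ s) (List.upTo (suc m)))

module Submission where

-- Identities between formal sums are proved up to reordering of terms
-- (_↭_), which preserves all coefficients.  (1) Renaming variables is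
-- multiplicative and moves the bounds of integration, so renaming Q gives
-- the integral with permuted factors and moved bounds; exchanging the
-- bounds negates it.  Homogeneity, and degree bounds in a single variable,
-- are instances of one weight argument on exponent vectors.  (3) Only the
-- factor (t - x_i)^m involves x_i for i ≥ 3, and its top coefficient in x_i
-- is (-1)^m.  (2) For a homogeneous polynomial of degree D the coefficient
-- of x₁^D is a constant; for Q it is -∫₀¹ t^a (t - 1)^m dt, a = l + (n-1)m,
-- computed after dropping every term involving x₂, …, and evaluated to
-- (-1)^m m! / ((a+1)⋯(a+m+1)) from the recursion of this Beta integral.
-- Its nonvanishing also shows that Q and all the Qexcept are nonzero.

open import Defs
open import Data.Nat using (ℕ; suc; _+_; _*_)
open import Data.Integer using (+_; -_; _^_)
open import Data.Fin using (Fin; zero; suc)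
open import Data.Fin.Permutation using (Permutation′; _⟨$⟩ʳ_; transpose)
open import Data.Fin.Permutation using (_⟨$⟩ˡ_; inverseˡ; inverseʳ; lift₀)
open import Data.Product using (_×_)
open import Relation.Binary.PropositionalEquality using (_≡_)

open import Data.Nat as ℕ using (_!)
import Data.Nat.Properties as ℕP
open import Data.Rational as ℚ using (ℚ; 0ℚ; 1ℚ)
import Data.Rational.Properties as ℚP
open import Data.Integer as ℤ using (ℤ)
import Data.Integer.Properties as ℤP
open import Data.Integer.Solver using () renaming (module +-*-Solver to ℤ-Solver)
open import Data.Nat.Solver using () renaming (module +-*-Solver to ℕ-Solver)
open import Data.Nat.Coprimality using (Coprime; 1-coprimeTo) renaming (sym to coprime-sym)
open import Data.Fin using () renaming (zero to fzero; suc to fsuc; _≟_ to _≟F_)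
import Data.Fin.Properties as Finₚ
open import Data.Vec as Vec using (Vec; []; _∷_; lookup; replicate; zipWith; tabulate; updateAt)
open import Data.Vec.Properties
  using (≡-dec; lookup∘tabulate; tabulate∘lookup; tabulate-cong; lookup-zipWith; lookup-replicate;
         lookup∘updateAt; lookup∘updateAt′; updateAt-commutes)
open import Data.List as List using (List; []; _∷_; _++_; concatMap; allFin; filterᵇ)
import Data.List.Properties as LP
open import Data.List.Relation.Binary.Permutation.Propositional
  using (_↭_; ↭-refl; ↭-prep; ↭-sym; ↭-trans; ↭-reflexive; ↭⇒↭ₛ; module PermutationReasoning)
import Data.List.Relation.Binary.Permutation.Propositional.Properties as ↭P
open import Data.List.Relation.Binary.BagAndSetEquality using (∼bag⇒↭)
open import Data.List.Membership.Propositional using (_∈_)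
open import Data.List.Membership.Propositional.Properties using (∈-allFin; ∈-map⁺)
open import Data.List.Membership.Propositional.Properties.WithK using (unique∧set⇒bag)
import Data.List.Relation.Unary.Unique.Propositional.Properties as Unique
open import Data.List.Relation.Unary.Unique.Propositional using (Unique)
open import Data.List.Relation.Unary.AllPairs using ([]; _∷_)
open import Data.List.Relation.Unary.Any using (here; there)
open import Data.Product using (_,_; proj₁; proj₂; Σ-syntax)
open import Data.Sum using (_⊎_; inj₁; inj₂; [_,_])
open import Data.List.Relation.Unary.All as All using (All; []; _∷_)
import Data.List.Relation.Unary.All.Properties as All
open import Data.Bool using (true; false; if_then_else_; not; T?)
open import Relation.Nullary using (¬_; Dec; yes; no; does; contradiction)
open import Relation.Nullary.Decidable using (does-⇔; dec-true; dec-false)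
open import Function.Bundles using (_⇔_; mk⇔; Equivalence)
open import Function using (_∘′_; case_of_)
open import Data.List.Relation.Binary.Permutation.Setoid.Properties ℚP.≡-setoid using (foldr-commMonoid)
open import Relation.Binary.PropositionalEquality
  using (refl; sym; trans; cong; cong₂; subst; subst₂; module ≡-Reasoning)
open import Algebra.Properties.CommutativeSemigroup ℕP.+-commutativeSemigroup
  using () renaming (interchange to ℕ-+-interchange; xy∙z≈xz∙y to ℕ-+-rightComm)
open import Algebra.Properties.Group ℚP.+-0-group using () renaming (⁻¹-involutive to ℚ-neg-involutive)

infixl 6 _⊕_
_⊕_ : ∀ {n} → Exp n → Exp n → Exp n
_⊕_ = zipWith ℕ._+_

zeros : ∀ {n} → Exp n
zeros = replicate _ 0

⊕-comm : ∀ {n} (e f : Exp n) → e ⊕ f ≡ f ⊕ e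
⊕-comm []      []      = refl
⊕-comm (x ∷ e) (y ∷ f) = cong₂ _∷_ (ℕP.+-comm x y) (⊕-comm e f)

⊕-assoc : ∀ {n} (e f g : Exp n) → (e ⊕ f) ⊕ g ≡ e ⊕ (f ⊕ g)
⊕-assoc []      []      []      = refl
⊕-assoc (x ∷ e) (y ∷ f) (z ∷ g) = cong₂ _∷_ (ℕP.+-assoc x y z) (⊕-assoc e f g)

⊕-identityˡ : ∀ {n} (e : Exp n) → zeros ⊕ e ≡ e
⊕-identityˡ []      = refl
⊕-identityˡ (x ∷ e) = cong (x ∷_) (⊕-identityˡ e)

⊕≡zeros : ∀ {n} (e f : Exp n) → e ⊕ f ≡ zeros → e ≡ zeros × f ≡ zeros
⊕≡zeros []      []      _  = refl , refl
⊕≡zeros (x ∷ e) (y ∷ f) eq with ⊕≡zeros e f (cong Vec.tail eq)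
... | e≡0 , f≡0 = cong₂ _∷_ (ℕP.m+n≡0⇒m≡0 x (cong Vec.head eq)) e≡0 , cong₂ _∷_ (ℕP.m+n≡0⇒n≡0 x (cong Vec.head eq)) f≡0

sumℕ-⊕ : ∀ {n} (e f : Exp n) → sumℕ (e ⊕ f) ≡ sumℕ e ℕ.+ sumℕ f
sumℕ-⊕ []      []      = refl
sumℕ-⊕ (x ∷ e) (y ∷ f) = begin
  (x ℕ.+ y) ℕ.+ sumℕ (e ⊕ f)      ≡⟨ cong ((x ℕ.+ y) ℕ.+_) (sumℕ-⊕ e f) ⟩
  (x ℕ.+ y) ℕ.+ (sumℕ e ℕ.+ sumℕ f) ≡⟨ ℕ-+-interchange x y (sumℕ e) (sumℕ f) ⟩
  (x ℕ.+ sumℕ e) ℕ.+ (y ℕ.+ sumℕ f) ∎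
  where open ≡-Reasoning

sumℕ-zeros : ∀ n → sumℕ (replicate n 0) ≡ 0
sumℕ-zeros ℕ.zero  = refl
sumℕ-zeros (suc n) = sumℕ-zeros n

Term : ℕ → Set
Term n = ℚ × Exp n

infixl 7 _*ₜ_
_*ₜ_ : ∀ {n} → Term n → Term n → Term n
(c , e) *ₜ (d , f) = (c ℚ.* d , e ⊕ f)

*ₜ-assoc : ∀ {n} (a b c : Term n) → (a *ₜ b) *ₜ c ≡ a *ₜ (b *ₜ c)
*ₜ-assoc (x , e) (y , f) (z , g) = cong₂ _,_ (ℚP.*-assoc x y z) (⊕-assoc e f g)

*ₜ-comm : ∀ {n} (a b : Term n) → a *ₜ b ≡ b *ₜ a
*ₜ-comm (x , e) (y , f) = cong₂ _,_ (ℚP.*-comm x y) (⊕-comm e f)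

*P-++ˡ : ∀ {n} (p p′ q : Poly n) → (p ++ p′) *P q ≡ p *P q ++ p′ *P q
*P-++ˡ []      p′ q = refl
*P-++ˡ (a ∷ p) p′ q = trans (cong (List.map (a *ₜ_) q ++_) (*P-++ˡ p p′ q))
                            (sym (LP.++-assoc (List.map (a *ₜ_) q) (p *P q) (p′ *P q)))

*P-mapˡ : ∀ {n} (a : Term n) (q r : Poly n) → List.map (a *ₜ_) q *P r ≡ List.map (a *ₜ_) (q *P r)
*P-mapˡ a []      r = refl
*P-mapˡ a (b ∷ q) r = begin
  List.map ((a *ₜ b) *ₜ_) r ++ List.map (a *ₜ_) q *P r
    ≡⟨ cong₂ _++_ (trans (LP.map-cong (*ₜ-assoc a b) r) (LP.map-∘ r)) (*P-mapˡ a q r) ⟩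
  List.map (a *ₜ_) (List.map (b *ₜ_) r) ++ List.map (a *ₜ_) (q *P r)
    ≡⟨ sym (LP.map-++ (a *ₜ_) (List.map (b *ₜ_) r) (q *P r)) ⟩
  List.map (a *ₜ_) (List.map (b *ₜ_) r ++ q *P r) ∎
  where open ≡-Reasoning

*P-assoc : ∀ {n} (p q r : Poly n) → (p *P q) *P r ≡ p *P (q *P r)
*P-assoc []      q r = refl
*P-assoc (a ∷ p) q r = trans (*P-++ˡ (List.map (a *ₜ_) q) (p *P q) r)
                             (cong₂ _++_ (*P-mapˡ a q r) (*P-assoc p q r))

concatMap-↭ : ∀ {A B : Set} (f : A → List B) {xs ys : List A} →
              xs ↭ ys → concatMap f xs ↭ concatMap f ys
concatMap-↭ f _↭_.refl           = ↭-refl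
concatMap-↭ f (_↭_.prep x p)     = ↭P.++⁺ˡ (f x) (concatMap-↭ f p)
concatMap-↭ f (_↭_.swap x y p)   =
  ↭-trans (↭P.++⁺ˡ (f x) (↭P.++⁺ˡ (f y) (concatMap-↭ f p))) (↭P.shifts (f x) (f y))
concatMap-↭ f (_↭_.trans p q)    = ↭-trans (concatMap-↭ f p) (concatMap-↭ f q)

*P-congʳ : ∀ {n} (p : Poly n) {q q′ : Poly n} → q ↭ q′ → p *P q ↭ p *P q′
*P-congʳ []      qq = ↭-refl
*P-congʳ (a ∷ p) qq = ↭P.++⁺ (↭P.map⁺ (a *ₜ_) qq) (*P-congʳ p qq)

*P-cong : ∀ {n} {p p′ q q′ : Poly n} → p ↭ p′ → q ↭ q′ → p *P q ↭ p′ *P q′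
*P-cong {p′ = p′} {q = q} pp qq =
  ↭-trans (concatMap-↭ (λ a → List.map (a *ₜ_) q) pp) (*P-congʳ p′ qq)

*P-zeroʳ : ∀ {n} (p : Poly n) → p *P [] ≡ []
*P-zeroʳ []      = refl
*P-zeroʳ (a ∷ p) = *P-zeroʳ p

concatMap-∷ : ∀ {A B : Set} (f : A → B) (g : A → List B) (xs : List A) →
              concatMap (λ x → f x ∷ g x) xs ↭ List.map f xs ++ concatMap g xs
concatMap-∷ f g []       = ↭-refl
concatMap-∷ f g (x ∷ xs) = ↭-prep (f x)
  (↭-trans (↭P.++⁺ˡ (g x) (concatMap-∷ f g xs)) (↭P.shifts (g x) (List.map f xs)))

*P-comm : ∀ {n} (p q : Poly n) → p *P q ↭ q *P p
*P-comm []      q = ↭-reflexive (sym (*P-zeroʳ q))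
*P-comm (a ∷ p) q = ↭-trans (↭P.++⁺ˡ (List.map (a *ₜ_) q) (*P-comm p q)) (↭-sym (↭-trans
  (concatMap-∷ (_*ₜ a) (λ b → List.map (b *ₜ_) p) q)
  (↭-reflexive (cong (_++ q *P p) (LP.map-cong (λ b → *ₜ-comm b a) q)))))

*P-leftComm : ∀ {n} (p q r : Poly n) → p *P (q *P r) ↭ q *P (p *P r)
*P-leftComm p q r = ↭-trans (↭-reflexive (sym (*P-assoc p q r)))
  (↭-trans (*P-cong (*P-comm p q) ↭-refl) (↭-reflexive (*P-assoc q p r)))

prodP-↭ : ∀ {n} {Fs Gs : List (Poly n)} → Fs ↭ Gs → prodP Fs ↭ prodP Gs
prodP-↭ _↭_.refl          = ↭-refl
prodP-↭ (_↭_.prep F p)    = *P-congʳ F (prodP-↭ p)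
prodP-↭ (_↭_.swap F G p)  = ↭-trans (*P-leftComm F G _) (*P-congʳ G (*P-congʳ F (prodP-↭ p)))
prodP-↭ (_↭_.trans p q)   = ↭-trans (prodP-↭ p) (prodP-↭ q)

-- Sums over the terms of a polynomial.  Such sums do not depend on the
-- order of the terms; coeff p e is one of them.

sumℚ : List ℚ → ℚ
sumℚ = List.foldr ℚ._+_ 0ℚ

Σₜ : ∀ {n} → (Term n → ℚ) → Poly n → ℚ
Σₜ f p = sumℚ (List.map f p)

Σₜ-↭ : ∀ {n} (f : Term n → ℚ) {p q : Poly n} → p ↭ q → Σₜ f p ≡ Σₜ f q
Σₜ-↭ f pq = foldr-commMonoid ℚP.+-0-isCommutativeMonoid (↭⇒↭ₛ (↭P.map⁺ f pq))

Σₜ-++ : ∀ {n} (f : Term n → ℚ) (p q : Poly n) → Σₜ f (p ++ q) ≡ Σₜ f p ℚ.+ Σₜ f q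
Σₜ-++ f []      q = sym (ℚP.+-identityˡ (Σₜ f q))
Σₜ-++ f (a ∷ p) q = trans (cong (f a ℚ.+_) (Σₜ-++ f p q)) (sym (ℚP.+-assoc (f a) (Σₜ f p) (Σₜ f q)))

coeffₜ : ∀ {n} → Term n → Exp n → ℚ
coeffₜ (c , e′) e = if does (≡-dec ℕ._≟_ e′ e) then c else 0ℚ

Σₜ-map : ∀ {n} (f g : Term n → ℚ) {h : Term n → Term n} → (∀ t → f (h t) ≡ g t) → ∀ p → Σₜ f (List.map h p) ≡ Σₜ g p
Σₜ-map f g f∘h≗g []      = refl
Σₜ-map f g f∘h≗g (t ∷ p) = cong₂ ℚ._+_ (f∘h≗g t) (Σₜ-map f g f∘h≗g p)

Σₜ-neg : ∀ {n} (f : Term n → ℚ) p → Σₜ (λ t → ℚ.- f t) p ≡ ℚ.- Σₜ f p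
Σₜ-neg f []      = refl
Σₜ-neg f (t ∷ p) = trans (cong (ℚ.- f t ℚ.+_) (Σₜ-neg f p)) (sym (ℚP.neg-distrib-+ (f t) (Σₜ f p)))

coeffₜ-self : ∀ {n} c (e : Exp n) → coeffₜ (c , e) e ≡ c
coeffₜ-self c e = cong (λ b → if b then c else 0ℚ) (dec-true (≡-dec ℕ._≟_ e e) refl)

coeffₜ-neg : ∀ {n} c (e′ e : Exp n) → coeffₜ (ℚ.- c , e′) e ≡ ℚ.- coeffₜ (c , e′) e
coeffₜ-neg c e′ e with does (≡-dec ℕ._≟_ e′ e)
... | true  = refl
... | false = refl

coeff-Σₜ : ∀ {n} (p : Poly n) e → coeff p e ≡ Σₜ (λ t → coeffₜ t e) p
coeff-Σₜ []             e = refl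
coeff-Σₜ ((c , e′) ∷ p) e with ≡-dec ℕ._≟_ e′ e
... | yes _ = cong (c ℚ.+_) (coeff-Σₜ p e)
... | no  _ = trans (coeff-Σₜ p e) (sym (ℚP.+-identityˡ _))

coeff-↭ : ∀ {n} {p q : Poly n} → p ↭ q → p ≈ q
coeff-↭ {p = p} {q} pq e = trans (coeff-Σₜ p e) (trans (Σₜ-↭ (λ t → coeffₜ t e) pq) (sym (coeff-Σₜ q e)))

coeff-++ : ∀ {n} (p q : Poly n) e → coeff (p ++ q) e ≡ coeff p e ℚ.+ coeff q e
coeff-++ p q e = trans (coeff-Σₜ (p ++ q) e) (trans (Σₜ-++ (λ t → coeffₜ t e) p q)
  (sym (cong₂ ℚ._+_ (coeff-Σₜ p e) (coeff-Σₜ q e))))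

coeff-∷ : ∀ {n} (a : Term n) (p : Poly n) e → coeff (a ∷ p) e ≡ coeffₜ a e ℚ.+ coeff p e
coeff-∷ a p e = trans (coeff-Σₜ (a ∷ p) e) (cong (coeffₜ a e ℚ.+_) (sym (coeff-Σₜ p e)))

vec-ext : ∀ {A : Set} {n} {u v : Vec A n} → (∀ i → lookup u i ≡ lookup v i) → u ≡ v
vec-ext {u = u} {v} h = trans (sym (tabulate∘lookup u)) (trans (tabulate-cong h) (tabulate∘lookup v))

tabulate-zero : ∀ n → tabulate {n = n} (λ _ → 0) ≡ zeros
tabulate-zero n = vec-ext λ i → trans (lookup∘tabulate _ i) (sym (lookup-replicate i 0))

-- Renaming along g replaces the exponent vector e
-- by e ∘ g; rename σ is renaming along σ⁻¹, i.e. it substitutes x_{σ i}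
-- for x_i.  Renaming is a ring homomorphism that moves the bounds of
-- integration, so it acts on Q by permuting the factors of the integrand.

renₜ : ∀ {n} → (Fin n → Fin n) → Term n → Term n
renₜ g (c , e) = (c , tabulate (λ j → lookup e (g j)))

renameBy : ∀ {n} → (Fin n → Fin n) → Poly n → Poly n
renameBy g = List.map (renₜ g)

renameBy-*P : ∀ {n} (g : Fin n → Fin n) p q → renameBy g (p *P q) ≡ renameBy g p *P renameBy g q
renameBy-*P g []      q = refl
renameBy-*P g (a ∷ p) q = trans (LP.map-++ (renₜ g) (List.map (a *ₜ_) q) (p *P q))
  (cong₂ _++_ (trans (sym (LP.map-∘ q)) (trans (LP.map-cong (renₜ-*ₜ a) q) (LP.map-∘ q)))
              (renameBy-*P g p q))
  where
  renₜ-*ₜ : ∀ a b → renₜ g (a *ₜ b) ≡ renₜ g a *ₜ renₜ g b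
  renₜ-*ₜ (c , e) (d , f) = cong (c ℚ.* d ,_) (vec-ext λ i → begin
    lookup (tabulate (λ j → lookup (e ⊕ f) (g j))) i            ≡⟨ lookup∘tabulate _ i ⟩
    lookup (e ⊕ f) (g i)                                        ≡⟨ lookup-zipWith ℕ._+_ (g i) e f ⟩
    lookup e (g i) ℕ.+ lookup f (g i)                           ≡⟨ sym (cong₂ ℕ._+_ (lookup∘tabulate _ i) (lookup∘tabulate _ i)) ⟩
    lookup e′ i ℕ.+ lookup f′ i                                 ≡⟨ sym (lookup-zipWith ℕ._+_ i e′ f′) ⟩
    lookup (e′ ⊕ f′) i                                          ∎)
    where
    open ≡-Reasoning
    e′ = tabulate (λ j → lookup e (g j))
    f′ = tabulate (λ j → lookup f (g j))

renameBy-const : ∀ {n} (g : Fin n → Fin n) c → renameBy g (const c) ≡ const c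
renameBy-const g c = cong (λ v → (c , v) ∷ []) (vec-ext λ i →
  trans (lookup∘tabulate _ i) (trans (lookup-replicate (g i) 0) (sym (lookup-replicate i 0))))

renameBy-^P : ∀ {n} (g : Fin n → Fin n) p k → renameBy g (p ^P k) ≡ renameBy g p ^P k
renameBy-^P g p ℕ.zero  = renameBy-const g 1ℚ
renameBy-^P g p (suc k) = trans (renameBy-*P g p (p ^P k)) (cong (renameBy g p *P_) (renameBy-^P g p k))

renameBy-prodP : ∀ {n} (g : Fin n → Fin n) Fs → renameBy g (prodP Fs) ≡ prodP (List.map (renameBy g) Fs)
renameBy-prodP g []       = renameBy-const g 1ℚ
renameBy-prodP g (F ∷ Fs) = trans (renameBy-*P g F (prodP Fs)) (cong (renameBy g F *P_) (renameBy-prodP g Fs))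

renameBy--P : ∀ {n} (g : Fin n → Fin n) p q → renameBy g (p -P q) ≡ renameBy g p -P renameBy g q
renameBy--P g p q = trans (LP.map-++ (renₜ g) p (-P q)) (cong (renameBy g p ++_) (negate q))
  where
  negate : ∀ q → renameBy g (-P q) ≡ -P renameBy g q
  negate []      = refl
  negate (a ∷ q) = cong (_ ∷_) (negate q)

renameBy-var : ∀ {n} (σ : Permutation′ n) i → renameBy (σ ⟨$⟩ˡ_) (var i) ≡ var (σ ⟨$⟩ʳ i)
renameBy-var σ i = cong (λ v → (1ℚ , v) ∷ []) (vec-ext λ j →
  trans (lookup∘tabulate _ j) (trans (lookup∘tabulate _ (σ ⟨$⟩ˡ j))
    (trans (cong (λ b → if b then 1 else 0) (does-⇔ moved (i ≟F σ ⟨$⟩ˡ j) (σ ⟨$⟩ʳ i ≟F j)))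
           (sym (lookup∘tabulate _ j)))))
  where
  moved : ∀ {j} → (i ≡ σ ⟨$⟩ˡ j) ⇔ (σ ⟨$⟩ʳ i ≡ j)
  moved = mk⇔ (λ { refl → inverseʳ σ }) (λ { refl → sym (inverseˡ σ) })

renameBy-integrand : ∀ {n} (σ : Permutation′ n) l m (J : List (Fin n)) →
  renameBy (lift₀ σ ⟨$⟩ˡ_) (integrand l m J) ≡ integrand l m (List.map (σ ⟨$⟩ʳ_) J)
renameBy-integrand σ l m J = trans (renameBy-*P g (T ^P l) _) (cong₂ _*P_
    (trans (renameBy-^P g T l) (cong (_^P l) (renameBy-var (lift₀ σ) fzero)))
    (trans (renameBy-prodP g (List.map factor J)) (cong prodP (begin
      List.map (renameBy g) (List.map factor J)   ≡⟨ sym (LP.map-∘ J) ⟩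
      List.map (renameBy g ∘′ factor) J           ≡⟨ LP.map-cong renamed-factor J ⟩
      List.map (factor ∘′ (σ ⟨$⟩ʳ_)) J            ≡⟨ LP.map-∘ J ⟩
      List.map factor (List.map (σ ⟨$⟩ʳ_) J)      ∎))))
  where
  open ≡-Reasoning
  g = lift₀ σ ⟨$⟩ˡ_
  factor : Fin _ → Poly _
  factor j = (T -P X j) ^P m
  renamed-factor : ∀ j → renameBy g (factor j) ≡ factor (σ ⟨$⟩ʳ j)
  renamed-factor j = trans (renameBy-^P g _ m) (cong (_^P m) (trans (renameBy--P g T (X j))
    (cong₂ _-P_ (renameBy-var (lift₀ σ) fzero) (renameBy-var (lift₀ σ) (fsuc j)))))

integralₜ : ∀ {n} → Fin n → Fin n → Term (suc n) → Poly n
integralₜ a b (c , k ∷ e) =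
  (c ÷ℕ suc k , addAt b (suc k) e) ∷ (ℚ.- (c ÷ℕ suc k) , addAt a (suc k) e) ∷ []

integral-concatMap : ∀ {n} (a b : Fin n) P → integral a b P ≡ concatMap (integralₜ a b) P
integral-concatMap a b []                  = refl
integral-concatMap a b ((c , k ∷ e) ∷ P) = cong (λ z → _ ∷ _ ∷ z) (integral-concatMap a b P)

integral-↭ : ∀ {n} (a b : Fin n) {P P′} → P ↭ P′ → integral a b P ↭ integral a b P′
integral-↭ a b {P} {P′} pp = ↭-trans (↭-reflexive (integral-concatMap a b P))
  (↭-trans (concatMap-↭ (integralₜ a b) pp) (↭-reflexive (sym (integral-concatMap a b P′))))

integral-++ : ∀ {n} (a b : Fin n) P R → integral a b (P ++ R) ≡ integral a b P ++ integral a b R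
integral-++ a b P R = trans (integral-concatMap a b (P ++ R)) (trans (LP.concatMap-++ (integralₜ a b) P R)
  (sym (cong₂ _++_ (integral-concatMap a b P) (integral-concatMap a b R))))

integral-flip : ∀ {n} (a b : Fin n) P → integral b a P ↭ -P integral a b P
integral-flip a b []                  = ↭-refl
integral-flip a b ((c , k ∷ e) ∷ P) = ↭-trans (_↭_.swap _ _ (integral-flip a b P))
  (↭-reflexive (cong (λ z → (ℚ.- c′ , addAt b (suc k) e) ∷ (z , addAt a (suc k) e) ∷ -P integral a b P)
                     (sym (ℚ-neg-involutive c′))))
  where c′ = c ÷ℕ suc k

renameBy-integral : ∀ {n} (σ : Permutation′ n) a b P →
  renameBy (σ ⟨$⟩ˡ_) (integral a b P) ≡ integral (σ ⟨$⟩ʳ a) (σ ⟨$⟩ʳ b) (renameBy (lift₀ σ ⟨$⟩ˡ_) P)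
renameBy-integral σ a b []                  = refl
renameBy-integral σ a b ((c , k ∷ e) ∷ P) =
  cong₂ _∷_ (cong (_ ,_) (renamed-addAt b)) (cong₂ _∷_ (cong (_ ,_) (renamed-addAt a)) (renameBy-integral σ a b P))
  where
  e′ = tabulate (λ j → lookup e (σ ⟨$⟩ˡ j))
  renamed-addAt : ∀ x → tabulate (λ j → lookup (addAt x (suc k) e) (σ ⟨$⟩ˡ j)) ≡ addAt (σ ⟨$⟩ʳ x) (suc k) e′
  renamed-addAt x = vec-ext λ j → trans (lookup∘tabulate _ j) (pointwise j (σ ⟨$⟩ʳ x ≟F j))
    where
    pointwise : ∀ j → Dec (σ ⟨$⟩ʳ x ≡ j) → lookup (addAt x (suc k) e) (σ ⟨$⟩ˡ j) ≡ lookup (addAt (σ ⟨$⟩ʳ x) (suc k) e′) j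
    pointwise j (yes refl) = begin
      lookup (addAt x (suc k) e) (σ ⟨$⟩ˡ (σ ⟨$⟩ʳ x)) ≡⟨ cong (lookup (addAt x (suc k) e)) (inverseˡ σ) ⟩
      lookup (addAt x (suc k) e) x                   ≡⟨ lookup∘updateAt x e ⟩
      lookup e x ℕ.+ suc k                           ≡⟨ cong (ℕ._+ suc k) (trans (cong (lookup e) (sym (inverseˡ σ))) (sym (lookup∘tabulate _ (σ ⟨$⟩ʳ x)))) ⟩
      lookup e′ (σ ⟨$⟩ʳ x) ℕ.+ suc k                 ≡⟨ sym (lookup∘updateAt (σ ⟨$⟩ʳ x) e′) ⟩
      lookup (addAt (σ ⟨$⟩ʳ x) (suc k) e′) (σ ⟨$⟩ʳ x) ∎
      where open ≡-Reasoning
    pointwise j (no x′≢j) = begin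
      lookup (addAt x (suc k) e) (σ ⟨$⟩ˡ j)          ≡⟨ lookup∘updateAt′ (σ ⟨$⟩ˡ j) x (λ eq → x′≢j (trans (cong (σ ⟨$⟩ʳ_) (sym eq)) (inverseʳ σ))) e ⟩
      lookup e (σ ⟨$⟩ˡ j)                            ≡⟨ sym (lookup∘tabulate _ j) ⟩
      lookup e′ j                                    ≡⟨ sym (lookup∘updateAt′ j (σ ⟨$⟩ʳ x) (λ eq → x′≢j (sym eq)) e′) ⟩
      lookup (addAt (σ ⟨$⟩ʳ x) (suc k) e′) j         ∎
      where open ≡-Reasoning

allFin-↭ : ∀ {n} (σ : Permutation′ n) → List.map (σ ⟨$⟩ʳ_) (allFin n) ↭ allFin n
allFin-↭ {n} σ = ∼bag⇒↭ (unique∧set⇒bag (Unique.map⁺ σ-injective (Unique.allFin⁺ n)) (Unique.allFin⁺ n)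
  (λ {x} → mk⇔ (λ _ → ∈-allFin x)
                (λ _ → subst (_∈ List.map (σ ⟨$⟩ʳ_) (allFin n)) (inverseʳ σ) (∈-map⁺ (σ ⟨$⟩ʳ_) (∈-allFin (σ ⟨$⟩ˡ x))))))
  where
  σ-injective : ∀ {x y} → σ ⟨$⟩ʳ x ≡ σ ⟨$⟩ʳ y → x ≡ y
  σ-injective {x} {y} eq = trans (sym (inverseˡ σ)) (trans (cong (σ ⟨$⟩ˡ_) eq) (inverseˡ σ))

rename-Q : ∀ k m l (σ : Permutation′ (2 ℕ.+ k)) →
  rename σ (Q k m l) ↭ integral (σ ⟨$⟩ʳ i₁) (σ ⟨$⟩ʳ i₂) (integrand l m (allFin (2 ℕ.+ k)))
rename-Q k m l σ = ↭-trans
  (↭-reflexive (trans (renameBy-integral σ i₁ i₂ (integrand l m (allFin (2 ℕ.+ k))))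
                      (cong (integral _ _) (renameBy-integrand σ l m (allFin (2 ℕ.+ k))))))
  (integral-↭ _ _ (*P-congʳ (T ^P l) (prodP-↭ (↭P.map⁺ (λ j → (T -P X j) ^P m) (allFin-↭ σ)))))

Q-symmetric : ∀ k m l (σ : Permutation′ (2 ℕ.+ k)) → σ ⟨$⟩ʳ i₁ ≡ i₁ → σ ⟨$⟩ʳ i₂ ≡ i₂ →
              rename σ (Q k m l) ≈ Q k m l
Q-symmetric k m l σ fix₁ fix₂ = coeff-↭
  (subst₂ (λ a b → rename σ (Q k m l) ↭ integral a b (integrand l m (allFin (2 ℕ.+ k)))) fix₁ fix₂ (rename-Q k m l σ))

Q-antisymmetric : ∀ k m l → rename (transpose i₁ i₂) (Q k m l) ≈ -P Q k m l
Q-antisymmetric k m l = coeff-↭ (↭-trans (rename-Q k m l (transpose i₁ i₂))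
                                          (integral-flip i₁ i₂ (integrand l m (allFin (2 ℕ.+ k)))))

-- An additive map φ : Exp n → ℕ (the total degree, or the
-- exponent of a single variable) grades polynomials: p has weight d if all
-- its terms do, and weight at most r if all its terms do.

Additive : ∀ {n} → (Exp n → ℕ) → Set
Additive φ = ∀ e f → φ (e ⊕ f) ≡ φ e ℕ.+ φ f

HasWeight : ∀ {n} → (Exp n → ℕ) → ℕ → Poly n → Set
HasWeight φ d = All (λ t → φ (proj₂ t) ≡ d)

WeightAtMost : ∀ {n} → (Exp n → ℕ) → ℕ → Poly n → Set
WeightAtMost φ r = All (λ t → φ (proj₂ t) ℕ.≤ r)

coeff-HasWeight : ∀ {n} {φ : Exp n → ℕ} {d p} → HasWeight φ d p → ∀ e → ¬ (φ e ≡ d) → coeff p e ≡ 0ℚ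
coeff-HasWeight []                           e φe≢d = refl
coeff-HasWeight {p = (c , e′) ∷ p} (w ∷ ws) e φe≢d with ≡-dec ℕ._≟_ e′ e
... | yes refl = contradiction w φe≢d
... | no  _    = coeff-HasWeight ws e φe≢d

module Weighted {n} (φ : Exp n → ℕ) (φ-additive : Additive φ) where

  φ-zeros : φ zeros ≡ 0
  φ-zeros = ℕP.+-cancelˡ-≡ (φ zeros) _ _ (begin
    φ zeros ℕ.+ φ zeros  ≡⟨ sym (φ-additive zeros zeros) ⟩
    φ (zeros ⊕ zeros)    ≡⟨ cong φ (⊕-identityˡ zeros) ⟩
    φ zeros              ≡⟨ sym (ℕP.+-identityʳ (φ zeros)) ⟩
    φ zeros ℕ.+ 0        ∎)
    where open ≡-Reasoning

  weight-++ : ∀ {d p q} → HasWeight φ d p → HasWeight φ d q → HasWeight φ d (p ++ q)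
  weight-++ = All.++⁺

  weight--P : ∀ {d p} → HasWeight φ d p → HasWeight φ d (-P p)
  weight--P []       = []
  weight--P (w ∷ ws) = w ∷ weight--P ws

  weight-*P : ∀ {d d′ p q} → HasWeight φ d p → HasWeight φ d′ q → HasWeight φ (d ℕ.+ d′) (p *P q)
  weight-*P             []       wq = []
  weight-*P {p = a ∷ _} (w ∷ wp) wq =
    All.++⁺ (All.map⁺ (All.map (λ {b} w′ → trans (φ-additive (proj₂ a) (proj₂ b)) (cong₂ ℕ._+_ w w′)) wq))
            (weight-*P wp wq)

  weight-const : ∀ c → HasWeight φ 0 (const c)
  weight-const c = φ-zeros ∷ []

  weight-^P : ∀ {d p} k → HasWeight φ d p → HasWeight φ (d ℕ.* k) (p ^P k)
  weight-^P {d} {p} ℕ.zero  w = subst (λ d′ → HasWeight φ d′ (p ^P 0)) (sym (ℕP.*-zeroʳ d)) (weight-const 1ℚ)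
  weight-^P {d} {p} (suc k) w = subst (λ d′ → HasWeight φ d′ (p ^P suc k)) (sym (ℕP.*-suc d k)) (weight-*P w (weight-^P k w))

  weight-prodP : ∀ {d} (Fs : List (Poly n)) → All (HasWeight φ d) Fs →
                 HasWeight φ (d ℕ.* List.length Fs) (prodP Fs)
  weight-prodP {d} []       []       = subst (λ d′ → HasWeight φ d′ (prodP [])) (sym (ℕP.*-zeroʳ d)) (weight-const 1ℚ)
  weight-prodP {d} (F ∷ Fs) (w ∷ ws) = subst (λ d′ → HasWeight φ d′ (prodP (F ∷ Fs))) (sym (ℕP.*-suc d (List.length Fs)))
                                             (weight-*P w (weight-prodP Fs ws))

  weightAtMost-map-*ₜ : ∀ {r₀ r} (a : Term n) → φ (proj₂ a) ≡ r₀ → ∀ {R} →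
                        WeightAtMost φ r R → WeightAtMost φ (r₀ ℕ.+ r) (List.map (a *ₜ_) R)
  weightAtMost-map-*ₜ a refl []                  = []
  weightAtMost-map-*ₜ {r = r} a refl {b ∷ R} (w ∷ ws) =
    subst (ℕ._≤ φ (proj₂ a) ℕ.+ r) (sym (φ-additive (proj₂ a) (proj₂ b))) (ℕP.+-monoʳ-≤ (φ (proj₂ a)) w)
    ∷ weightAtMost-map-*ₜ a refl ws

unit : ∀ {n} → Fin n → Exp n
unit i = tabulate (λ j → if does (i ≟F j) then 1 else 0)

unit-self : ∀ {n} (i : Fin n) → lookup (unit i) i ≡ 1
unit-self i = trans (lookup∘tabulate _ i) (cong (λ b → if b then 1 else 0) (dec-true (i ≟F i) refl))

unit-other : ∀ {n} (i j : Fin n) → ¬ (i ≡ j) → lookup (unit i) j ≡ 0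
unit-other i j i≢j = trans (lookup∘tabulate _ j) (cong (λ b → if b then 1 else 0) (dec-false (i ≟F j) i≢j))

unit≡addAt : ∀ {n} (i : Fin n) → unit i ≡ addAt i 1 zeros
unit≡addAt i = vec-ext λ j → pointwise j (i ≟F j)
  where
  pointwise : ∀ j → Dec (i ≡ j) → lookup (unit i) j ≡ lookup (addAt i 1 zeros) j
  pointwise j (yes refl) = trans (unit-self i) (sym (trans (lookup∘updateAt i zeros) (cong (ℕ._+ 1) (lookup-replicate i 0))))
  pointwise j (no i≢j)   = trans (unit-other i j i≢j)
    (sym (trans (lookup∘updateAt′ j i (λ eq → i≢j (sym eq)) zeros) (lookup-replicate j 0)))

sumℕ-addAt : ∀ {n} (i : Fin n) r (e : Exp n) → sumℕ (addAt i r e) ≡ sumℕ e ℕ.+ r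
sumℕ-addAt fzero    r (x ∷ e) = ℕ-+-rightComm x r (sumℕ e)
sumℕ-addAt (fsuc i) r (x ∷ e) = trans (cong (x ℕ.+_) (sumℕ-addAt i r e)) (sym (ℕP.+-assoc x _ r))

module TotalDegree {n} = Weighted {n} sumℕ sumℕ-⊕

homogeneous-var : ∀ {n} (i : Fin n) → HasWeight sumℕ 1 (var i)
homogeneous-var {n} i = trans (cong sumℕ (unit≡addAt i)) (trans (sumℕ-addAt i 1 zeros) (cong (ℕ._+ 1) (sumℕ-zeros n))) ∷ []

homogeneous-integrand : ∀ {n} l m (J : List (Fin n)) →
                        HasWeight sumℕ (l ℕ.+ List.length J ℕ.* m) (integrand l m J)
homogeneous-integrand l m J = subst (λ d → HasWeight sumℕ d (integrand l m J))
  (cong₂ ℕ._+_ (ℕP.*-identityˡ l) (trans (cong (m ℕ.*_) (LP.length-map _ J)) (ℕP.*-comm m (List.length J))))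
  (weight-*P (weight-^P l (homogeneous-var fzero))
             (weight-prodP factors (All.map⁺ (All.universal homogeneous-factor J))))
  where
  open TotalDegree
  factors = List.map (λ j → (T -P X j) ^P m) J
  homogeneous-factor : ∀ j → HasWeight sumℕ m ((T -P X j) ^P m)
  homogeneous-factor j = subst (λ d → HasWeight sumℕ d ((T -P X j) ^P m)) (ℕP.*-identityˡ m)
    (weight-^P m (weight-++ (homogeneous-var fzero) (weight--P (homogeneous-var (fsuc j)))))

homogeneous-integral : ∀ {n d} (a b : Fin n) {P} → HasWeight sumℕ d P → HasWeight sumℕ (suc d) (integral a b P)
homogeneous-integral a b                    []       = []
homogeneous-integral {d = d} a b {(c , k ∷ e) ∷ P} (w ∷ ws) = raised b ∷ raised a ∷ homogeneous-integral a b ws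
  where
  raised : ∀ x → sumℕ (addAt x (suc k) e) ≡ suc d
  raised x = trans (sumℕ-addAt x (suc k) e) (trans (ℕP.+-suc _ k) (cong suc (trans (ℕP.+-comm _ k) w)))

degree : ℕ → ℕ → ℕ → ℕ
degree k m l = (2 ℕ.+ k) ℕ.* m ℕ.+ l ℕ.+ 1

degree-Q : ∀ k m l → suc (l ℕ.+ List.length (allFin (2 ℕ.+ k)) ℕ.* m) ≡ degree k m l
degree-Q k m l = begin
  suc (l ℕ.+ List.length (allFin (2 ℕ.+ k)) ℕ.* m) ≡⟨ cong (λ z → suc (l ℕ.+ z ℕ.* m)) (LP.length-tabulate {n = 2 ℕ.+ k} (λ x → x)) ⟩
  suc (l ℕ.+ (2 ℕ.+ k) ℕ.* m)                       ≡⟨ cong suc (ℕP.+-comm l _) ⟩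
  suc ((2 ℕ.+ k) ℕ.* m ℕ.+ l)                       ≡⟨ ℕP.+-comm 1 _ ⟩
  degree k m l                                      ∎
  where open ≡-Reasoning

homogeneous-Q : ∀ k m l → HasWeight sumℕ (degree k m l) (Q k m l)
homogeneous-Q k m l = subst (λ d → HasWeight sumℕ d (Q k m l)) (degree-Q k m l)
  (homogeneous-integral i₁ i₂ (homogeneous-integrand l m (allFin (2 ℕ.+ k))))

setAt : ∀ {n} → Fin n → ℕ → Exp n → Exp n
setAt i d e = updateAt e i (λ _ → d)

lookup-setAt-other : ∀ {n} (i j : Fin n) d e → ¬ (i ≡ j) → lookup (setAt i d e) j ≡ lookup e j
lookup-setAt-other i j d e i≢j = lookup∘updateAt′ j i (λ eq → i≢j (sym eq)) e

setAt-lookup : ∀ {n} (i : Fin n) (e : Exp n) → lookup e i ≡ 0 → setAt i 0 e ≡ e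
setAt-lookup fzero    (x ∷ e) refl = refl
setAt-lookup (fsuc i) (x ∷ e) x₀   = cong (x ∷_) (setAt-lookup i e x₀)

setAt-⊕ : ∀ {n} (i : Fin n) (e f : Exp n) → setAt i 0 (e ⊕ f) ≡ setAt i 0 e ⊕ setAt i 0 f
setAt-⊕ fzero    (x ∷ e) (y ∷ f) = refl
setAt-⊕ (fsuc i) (x ∷ e) (y ∷ f) = cong (x ℕ.+ y ∷_) (setAt-⊕ i e f)

coeffInₜ : ∀ {n} → Fin n → ℕ → Term n → Poly n
coeffInₜ i d (c , e) = if does (lookup e i ℕ.≟ d) then (c , setAt i 0 e) ∷ [] else []

coeffInₜ-yes : ∀ {n} (i : Fin n) d c e → lookup e i ≡ d → coeffInₜ i d (c , e) ≡ (c , setAt i 0 e) ∷ []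
coeffInₜ-yes i d c e eq = cong (λ b → if b then (c , setAt i 0 e) ∷ [] else []) (dec-true (lookup e i ℕ.≟ d) eq)

coeffInₜ-no : ∀ {n} (i : Fin n) d c e → ¬ (lookup e i ≡ d) → coeffInₜ i d (c , e) ≡ []
coeffInₜ-no i d c e neq = cong (λ b → if b then (c , setAt i 0 e) ∷ [] else []) (dec-false (lookup e i ℕ.≟ d) neq)

coeffIn-++ : ∀ {n} (i : Fin n) d p q → coeffIn i d (p ++ q) ≡ coeffIn i d p ++ coeffIn i d q
coeffIn-++ i d p q = LP.concatMap-++ (coeffInₜ i d) p q

coeffIn-↭ : ∀ {n} (i : Fin n) d {p q} → p ↭ q → coeffIn i d p ↭ coeffIn i d q
coeffIn-↭ i d = concatMap-↭ (coeffInₜ i d)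

coeffₜ-≢ : ∀ {n} c (e′ e : Exp n) → ¬ (e′ ≡ e) → coeffₜ (c , e′) e ≡ 0ℚ
coeffₜ-≢ c e′ e neq = cong (λ b → if b then c else 0ℚ) (dec-false (≡-dec ℕ._≟_ e′ e) neq)

coeffₜ-⇔ : ∀ {n n′} c (e₁ e₂ : Exp n) (f₁ f₂ : Exp n′) → (e₁ ≡ e₂) ⇔ (f₁ ≡ f₂) → coeffₜ (c , e₁) e₂ ≡ coeffₜ (c , f₁) f₂
coeffₜ-⇔ c e₁ e₂ f₁ f₂ iff = cong (λ b → if b then c else 0ℚ) (does-⇔ iff (≡-dec ℕ._≟_ e₁ e₂) (≡-dec ℕ._≟_ f₁ f₂))

coeff-coeffIn : ∀ {n} (i : Fin n) d p e → lookup e i ≡ 0 → coeff (coeffIn i d p) e ≡ coeff p (setAt i d e)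
coeff-coeffIn i d []             e e₀ = refl
coeff-coeffIn i d ((c , e′) ∷ p) e e₀ = begin
  coeff (coeffInₜ i d (c , e′) ++ coeffIn i d p) e             ≡⟨ coeff-++ (coeffInₜ i d (c , e′)) _ e ⟩
  coeff (coeffInₜ i d (c , e′)) e ℚ.+ coeff (coeffIn i d p) e ≡⟨ cong₂ ℚ._+_ (single (lookup e′ i ℕ.≟ d)) (coeff-coeffIn i d p e e₀) ⟩
  coeffₜ (c , e′) (setAt i d e) ℚ.+ coeff p (setAt i d e)     ≡⟨ sym (coeff-∷ (c , e′) p (setAt i d e)) ⟩
  coeff ((c , e′) ∷ p) (setAt i d e)                          ∎
  where
  open ≡-Reasoning
  reset⇔raise : lookup e′ i ≡ d → (setAt i 0 e′ ≡ e) ⇔ (e′ ≡ setAt i d e)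
  reset⇔raise e′ᵢ = mk⇔
    (λ { refl → vec-ext λ j → pointwise-raise j (i ≟F j) })
    (λ { refl → vec-ext λ j → pointwise-reset j (i ≟F j) })
    where
    pointwise-raise : ∀ j → Dec (i ≡ j) → lookup e′ j ≡ lookup (setAt i d (setAt i 0 e′)) j
    pointwise-raise j (yes refl) = trans e′ᵢ (sym (lookup∘updateAt i (setAt i 0 e′)))
    pointwise-raise j (no i≢j)   = sym (trans (lookup-setAt-other i j d (setAt i 0 e′) i≢j) (lookup-setAt-other i j 0 e′ i≢j))
    pointwise-reset : ∀ j → Dec (i ≡ j) → lookup (setAt i 0 (setAt i d e)) j ≡ lookup e j
    pointwise-reset j (yes refl) = trans (lookup∘updateAt i (setAt i d e)) (sym e₀)
    pointwise-reset j (no i≢j)   = trans (lookup-setAt-other i j 0 (setAt i d e) i≢j) (lookup-setAt-other i j d e i≢j)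
  single : Dec (lookup e′ i ≡ d) → coeff (coeffInₜ i d (c , e′)) e ≡ coeffₜ (c , e′) (setAt i d e)
  single (yes e′ᵢ) = begin
    coeff (coeffInₜ i d (c , e′)) e        ≡⟨ cong (λ z → coeff z e) (coeffInₜ-yes i d c e′ e′ᵢ) ⟩
    coeff ((c , setAt i 0 e′) ∷ []) e      ≡⟨ coeff-∷ (c , setAt i 0 e′) [] e ⟩
    coeffₜ (c , setAt i 0 e′) e ℚ.+ 0ℚ     ≡⟨ ℚP.+-identityʳ _ ⟩
    coeffₜ (c , setAt i 0 e′) e            ≡⟨ coeffₜ-⇔ c _ e e′ _ (reset⇔raise e′ᵢ) ⟩
    coeffₜ (c , e′) (setAt i d e)          ∎
  single (no e′ᵢ≢d) = trans (cong (λ z → coeff z e) (coeffInₜ-no i d c e′ e′ᵢ≢d))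
    (sym (coeffₜ-≢ c e′ (setAt i d e) (λ eq → e′ᵢ≢d (trans (cong (λ v → lookup v i) eq) (lookup∘updateAt i e)))))

coeff-coeffIn-≢0 : ∀ {n} (i : Fin n) d p e → ¬ (lookup e i ≡ 0) → coeff (coeffIn i d p) e ≡ 0ℚ
coeff-coeffIn-≢0 i d p e eᵢ≢0 = coeff-HasWeight (reset p) e eᵢ≢0
  where
  reset : ∀ p → HasWeight (λ e → lookup e i) 0 (coeffIn i d p)
  reset []             = []
  reset ((c , e′) ∷ p) = All.++⁺ (single (lookup e′ i ℕ.≟ d)) (reset p)
    where
    single : Dec (lookup e′ i ≡ d) → HasWeight (λ e → lookup e i) 0 (coeffInₜ i d (c , e′))
    single (yes e′ᵢ)  = subst (HasWeight _ 0) (sym (coeffInₜ-yes i d c e′ e′ᵢ)) (lookup∘updateAt i e′ ∷ [])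
    single (no e′ᵢ≢d) = subst (HasWeight _ 0) (sym (coeffInₜ-no i d c e′ e′ᵢ≢d)) []

sumℕ-setAt : ∀ {n} (i : Fin n) d (e : Exp n) → lookup e i ≡ 0 → sumℕ (setAt i d e) ≡ sumℕ e ℕ.+ d
sumℕ-setAt fzero    d (x ∷ e) refl = ℕP.+-comm d (sumℕ e)
sumℕ-setAt (fsuc i) d (x ∷ e) eᵢ   = trans (cong (x ℕ.+_) (sumℕ-setAt i d e eᵢ)) (sym (ℕP.+-assoc x (sumℕ e) d))

sumℕ≡0 : ∀ {n} (e : Exp n) → sumℕ e ≡ 0 → e ≡ zeros
sumℕ≡0 []      _  = refl
sumℕ≡0 (x ∷ e) eq = cong₂ _∷_ (ℕP.m+n≡0⇒m≡0 x eq) (sumℕ≡0 e (ℕP.m+n≡0⇒n≡0 x eq))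

coeff-const : ∀ {n} c (e : Exp n) → coeff (const c) e ≡ coeffₜ (c , zeros) e
coeff-const c e = trans (coeff-∷ (c , zeros) [] e) (ℚP.+-identityʳ _)

HasWeight⇒homogeneous : ∀ {n} {D} {p : Poly n} → HasWeight sumℕ D p → ∀ e → ¬ (coeff p e ≡ 0ℚ) → sumℕ e ≡ D
HasWeight⇒homogeneous {D = D} hom e coeff≢0 with sumℕ e ℕ.≟ D
... | yes eq  = eq
... | no  neq = contradiction (coeff-HasWeight hom e neq) coeff≢0

module Homogeneous {n} {D} {p : Poly n} (hom : HasWeight sumℕ D p) (i : Fin n) where

  top : ℚ
  top = coeff p (setAt i D zeros)

  coeff-const-top : ∀ e → coeff (const {n} top) e ≡ coeffₜ (top , zeros {n}) e
  coeff-const-top = coeff-const top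

  above-degree : ∀ d → D ℕ.< d → coeffIn i d p ≈ 0P
  above-degree d D<d e with lookup e i ℕ.≟ 0
  ... | no  eᵢ≢0 = coeff-coeffIn-≢0 i d p e eᵢ≢0
  ... | yes eᵢ≡0 = trans (coeff-coeffIn i d p e eᵢ≡0) (coeff-HasWeight hom (setAt i d e) λ sum≡D →
        ℕP.<-irrefl (sym sum≡D) (ℕP.<-≤-trans D<d (subst (d ℕ.≤_) (sym (sumℕ-setAt i d e eᵢ≡0)) (ℕP.m≤n+m d (sumℕ e)))))

  top-coefficient : coeffIn i D p ≈ const {n} top
  top-coefficient e with lookup e i ℕ.≟ 0
  ... | no eᵢ≢0 = trans (coeff-coeffIn-≢0 i D p e eᵢ≢0) (sym (trans (coeff-const-top e)
        (coeffₜ-≢ top (zeros {n}) e λ zeros≡e → eᵢ≢0 (trans (cong (λ v → lookup v i) (sym zeros≡e)) (lookup-replicate i 0)))))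
  ... | yes eᵢ≡0 with ≡-dec ℕ._≟_ e zeros
  ...   | yes refl = trans (coeff-coeffIn i D p zeros eᵢ≡0) (sym (trans (coeff-const-top zeros) (coeffₜ-self top (zeros {n}))))
  ...   | no  e≢0  = trans (coeff-coeffIn i D p e eᵢ≡0) (trans (coeff-HasWeight hom (setAt i D e) wrong-degree)
        (sym (trans (coeff-const-top e) (coeffₜ-≢ top (zeros {n}) e (λ zeros≡e → e≢0 (sym zeros≡e))))))
    where
    wrong-degree : ¬ (sumℕ (setAt i D e) ≡ D)
    wrong-degree sum≡D = e≢0 (sumℕ≡0 e (ℕP.+-cancelʳ-≡ D (sumℕ e) 0 (trans (sym (sumℕ-setAt i D e eᵢ≡0)) sum≡D)))

  exact-degree : ¬ (coeff p (setAt i D zeros) ≡ 0ℚ) → DegreeIn i D p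
  exact-degree top≢0 = (λ top≈0 → top≢0 (trans (sym (trans (coeff-const-top zeros) (coeffₜ-self top (zeros {n}))))
                                         (trans (sym (top-coefficient zeros)) (top≈0 zeros))))
               , above-degree

lookup-additive : ∀ {n} (j : Fin n) → Additive (λ e → lookup e j)
lookup-additive j = lookup-zipWith ℕ._+_ j

module ExponentOf {n} (j : Fin n) = Weighted (λ e → lookup e j) (lookup-additive j)

Free : ∀ {n} → Fin n → Poly n → Set
Free j = HasWeight (λ e → lookup e j) 0

free-var : ∀ {n} {j : Fin n} i → ¬ (i ≡ j) → Free j (var i)
free-var {j = j} i i≢j = unit-other i j i≢j ∷ []

coeffIn-map-*ₜ : ∀ {n} (j : Fin n) r d c₀ (e₀ : Exp n) → lookup e₀ j ≡ r → ∀ R →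
  coeffIn j (r ℕ.+ d) (List.map ((c₀ , e₀) *ₜ_) R) ≡ List.map ((c₀ , setAt j 0 e₀) *ₜ_) (coeffIn j d R)
coeffIn-map-*ₜ j r d c₀ e₀ e₀ⱼ []             = refl
coeffIn-map-*ₜ j r d c₀ e₀ e₀ⱼ ((c , e) ∷ R) = begin
  coeffInₜ j (r ℕ.+ d) (c₀ ℚ.* c , e₀ ⊕ e) ++ coeffIn j (r ℕ.+ d) (List.map ((c₀ , e₀) *ₜ_) R)
    ≡⟨ cong₂ _++_ (single (lookup e j ℕ.≟ d)) (coeffIn-map-*ₜ j r d c₀ e₀ e₀ⱼ R) ⟩
  List.map ((c₀ , setAt j 0 e₀) *ₜ_) (coeffInₜ j d (c , e)) ++ List.map ((c₀ , setAt j 0 e₀) *ₜ_) (coeffIn j d R)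
    ≡⟨ sym (LP.map-++ _ (coeffInₜ j d (c , e)) (coeffIn j d R)) ⟩
  List.map ((c₀ , setAt j 0 e₀) *ₜ_) (coeffInₜ j d (c , e) ++ coeffIn j d R) ∎
  where
  open ≡-Reasoning
  exponent : lookup (e₀ ⊕ e) j ≡ r ℕ.+ lookup e j
  exponent = trans (lookup-additive j e₀ e) (cong (ℕ._+ lookup e j) e₀ⱼ)
  single : Dec (lookup e j ≡ d) →
    coeffInₜ j (r ℕ.+ d) (c₀ ℚ.* c , e₀ ⊕ e) ≡ List.map ((c₀ , setAt j 0 e₀) *ₜ_) (coeffInₜ j d (c , e))
  single (yes eⱼ) = trans (coeffInₜ-yes j _ _ _ (trans exponent (cong (r ℕ.+_) eⱼ)))
    (sym (trans (cong (List.map _) (coeffInₜ-yes j d c e eⱼ)) (cong (λ v → (c₀ ℚ.* c , v) ∷ []) (sym (setAt-⊕ j e₀ e)))))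
  single (no eⱼ≢d) = trans (coeffInₜ-no j _ _ _ (λ eq → eⱼ≢d (ℕP.+-cancelˡ-≡ r _ _ (trans (sym exponent) eq))))
    (sym (cong (List.map _) (coeffInₜ-no j d c e eⱼ≢d)))

coeffIn-*P-free : ∀ {n} (j : Fin n) d {A} → Free j A → ∀ B → coeffIn j d (A *P B) ≡ A *P coeffIn j d B
coeffIn-*P-free j d []                       B = refl
coeffIn-*P-free j d {(c , e) ∷ A} (eⱼ ∷ free) B = trans (coeffIn-++ j d (List.map ((c , e) *ₜ_) B) (A *P B))
  (cong₂ _++_ (trans (coeffIn-map-*ₜ j 0 d c e eⱼ B) (cong (λ v → List.map ((c , v) *ₜ_) (coeffIn j d B)) (setAt-lookup j e eⱼ)))
              (coeffIn-*P-free j d free B))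

coeffIn-*P-freeʳ : ∀ {n} (j : Fin n) d {A} → Free j A → ∀ B → coeffIn j d (B *P A) ↭ coeffIn j d B *P A
coeffIn-*P-freeʳ j d {A} free B = ↭-trans (coeffIn-↭ j d (*P-comm B A))
  (↭-trans (↭-reflexive (coeffIn-*P-free j d free B)) (*P-comm A _))

coeffIn-above : ∀ {n} (j : Fin n) {r d p} → WeightAtMost (λ e → lookup e j) r p → r ℕ.< d → coeffIn j d p ≡ []
coeffIn-above j []                                   r<d = refl
coeffIn-above j {r} {d} {(c , e) ∷ p} (eⱼ≤r ∷ bound) r<d = trans
  (cong (_++ coeffIn j d p) (coeffInₜ-no j d c e (λ eⱼ≡d → ℕP.<-irrefl eⱼ≡d (ℕP.≤-<-trans eⱼ≤r r<d))))
  (coeffIn-above j bound r<d)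

-- Taking the coefficient of x_i commutes with integration between bounds
-- other than x_i (in the integrand x_i is variable i+1, after t).
coeffIn-integral : ∀ {n} (i a b : Fin n) d → ¬ (i ≡ a) → ¬ (i ≡ b) → ∀ P →
  coeffIn i d (integral a b P) ≡ integral a b (coeffIn (fsuc i) d P)
coeffIn-integral i a b d i≢a i≢b []                  = refl
coeffIn-integral i a b d i≢a i≢b ((c , k ∷ e) ∷ P) = begin
  coeffIn i d (integralₜ a b (c , k ∷ e) ++ integral a b P)
    ≡⟨ coeffIn-++ i d (integralₜ a b (c , k ∷ e)) (integral a b P) ⟩
  coeffIn i d (integralₜ a b (c , k ∷ e)) ++ coeffIn i d (integral a b P)
    ≡⟨ cong₂ _++_ (single (lookup e i ℕ.≟ d)) (coeffIn-integral i a b d i≢a i≢b P) ⟩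
  integral a b (coeffInₜ (fsuc i) d (c , k ∷ e)) ++ integral a b (coeffIn (fsuc i) d P)
    ≡⟨ sym (integral-++ a b (coeffInₜ (fsuc i) d (c , k ∷ e)) _) ⟩
  integral a b (coeffIn (fsuc i) d ((c , k ∷ e) ∷ P)) ∎
  where
  open ≡-Reasoning
  c′ = c ÷ℕ suc k
  exponent : ∀ x → ¬ (i ≡ x) → lookup (addAt x (suc k) e) i ≡ lookup e i
  exponent x i≢x = lookup∘updateAt′ i x i≢x e
  single : Dec (lookup e i ≡ d) → coeffIn i d (integralₜ a b (c , k ∷ e)) ≡ integral a b (coeffInₜ (fsuc i) d (c , k ∷ e))
  single (yes eᵢ) = begin
    coeffIn i d (integralₜ a b (c , k ∷ e))
      ≡⟨ cong₂ _++_ (coeffInₜ-yes i d c′ (addAt b (suc k) e) (trans (exponent b i≢b) eᵢ))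
                    (cong (_++ []) (coeffInₜ-yes i d (ℚ.- c′) (addAt a (suc k) e) (trans (exponent a i≢a) eᵢ))) ⟩
    (c′ , setAt i 0 (addAt b (suc k) e)) ∷ (ℚ.- c′ , setAt i 0 (addAt a (suc k) e)) ∷ []
      ≡⟨ cong₂ (λ u v → (c′ , u) ∷ (ℚ.- c′ , v) ∷ []) (updateAt-commutes i b i≢b e) (updateAt-commutes i a i≢a e) ⟩
    integral a b ((c , k ∷ setAt i 0 e) ∷ [])
      ≡⟨ cong (integral a b) (sym (coeffInₜ-yes (fsuc i) d c (k ∷ e) eᵢ)) ⟩
    integral a b (coeffInₜ (fsuc i) d (c , k ∷ e)) ∎
  single (no eᵢ≢d) = begin
    coeffIn i d (integralₜ a b (c , k ∷ e))
      ≡⟨ cong₂ _++_ (coeffInₜ-no i d c′ (addAt b (suc k) e) (λ eq → eᵢ≢d (trans (sym (exponent b i≢b)) eq)))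
                    (cong (_++ []) (coeffInₜ-no i d (ℚ.- c′) (addAt a (suc k) e) (λ eq → eᵢ≢d (trans (sym (exponent a i≢a)) eq)))) ⟩
    []
      ≡⟨ cong (integral a b) (sym (coeffInₜ-no (fsuc i) d c (k ∷ e) eᵢ≢d)) ⟩
    integral a b (coeffInₜ (fsuc i) d (c , k ∷ e)) ∎

-- Integers inside ℚ: ℤ→ℚ z = z/1 is the fraction with denominator 1, so
-- ring operations on such fractions are computed on the numerators.

coprime-1 : ∀ n → Coprime n 1
coprime-1 n = coprime-sym (1-coprimeTo n)

ℤ→ℚ-mkℚ : ∀ z → ℤ→ℚ z ≡ ℚ.mkℚ z 0 (coprime-1 ℤ.∣ z ∣)
ℤ→ℚ-mkℚ (+ n)      = ℚP.normalize-coprime (coprime-1 n)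
ℤ→ℚ-mkℚ ℤ.-[1+ n ] = cong ℚ.-_ (ℚP.normalize-coprime (coprime-1 (suc n)))

ℤ→ℚ-* : ∀ a b → ℤ→ℚ (a ℤ.* b) ≡ ℤ→ℚ a ℚ.* ℤ→ℚ b
ℤ→ℚ-* a b = sym (cong₂ ℚ._*_ (ℤ→ℚ-mkℚ a) (ℤ→ℚ-mkℚ b))

ℤ→ℚ-+ : ∀ a b → ℤ→ℚ (a ℤ.+ b) ≡ ℤ→ℚ a ℚ.+ ℤ→ℚ b
ℤ→ℚ-+ a b = trans (cong ℤ→ℚ (sym (cong₂ ℤ._+_ (ℤP.*-identityʳ a) (ℤP.*-identityʳ b))))
                  (sym (cong₂ ℚ._+_ (ℤ→ℚ-mkℚ a) (ℤ→ℚ-mkℚ b)))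

ℤ→ℚ-neg : ∀ a → ℤ→ℚ (ℤ.- a) ≡ ℚ.- ℤ→ℚ a
ℤ→ℚ-neg a = trans (ℤ→ℚ-mkℚ (ℤ.- a)) (trans (negate a) (cong ℚ.-_ (sym (ℤ→ℚ-mkℚ a))))
  where
  negate : ∀ a → ℚ.mkℚ (ℤ.- a) 0 (coprime-1 ℤ.∣ ℤ.- a ∣) ≡ ℚ.- ℚ.mkℚ a 0 (coprime-1 ℤ.∣ a ∣)
  negate (+ ℕ.zero)  = refl
  negate (+ suc n)   = refl
  negate ℤ.-[1+ n ]  = refl

reciprocal-inverse : ∀ a → (+ 1 ℚ./ suc a) ℚ.* ℤ→ℚ (+ suc a) ≡ 1ℚ
reciprocal-inverse a = trans
  (cong₂ ℚ._*_ (ℚP.normalize-coprime (1-coprimeTo (suc a))) (ℤ→ℚ-mkℚ (+ suc a)))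
  (ℚP.*-inverseˡ (ℚ.mkℚ (+ suc a) 0 (coprime-1 (suc a))))

÷ℕ-cancel : ∀ x a → (x ÷ℕ suc a) ℚ.* ℤ→ℚ (+ suc a) ≡ x
÷ℕ-cancel x a = begin
  (x ℚ.* (+ 1 ℚ./ suc a)) ℚ.* ℤ→ℚ (+ suc a)  ≡⟨ ℚP.*-assoc x _ _ ⟩
  x ℚ.* ((+ 1 ℚ./ suc a) ℚ.* ℤ→ℚ (+ suc a))  ≡⟨ cong (x ℚ.*_) (reciprocal-inverse a) ⟩
  x ℚ.* 1ℚ                                   ≡⟨ ℚP.*-identityʳ x ⟩
  x                                          ∎
  where open ≡-Reasoning

÷ℕ-unique : ∀ x z a → z ℚ.* ℤ→ℚ (+ suc a) ≡ x → x ÷ℕ suc a ≡ z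
÷ℕ-unique x z a z·a≡x = begin
  x ÷ℕ suc a                                        ≡⟨ cong (_÷ℕ suc a) (sym z·a≡x) ⟩
  (z ℚ.* ℤ→ℚ (+ suc a)) ℚ.* (+ 1 ℚ./ suc a)          ≡⟨ ℚP.*-assoc z _ _ ⟩
  z ℚ.* (ℤ→ℚ (+ suc a) ℚ.* (+ 1 ℚ./ suc a))          ≡⟨ cong (z ℚ.*_) (trans (ℚP.*-comm (ℤ→ℚ (+ suc a)) _) (reciprocal-inverse a)) ⟩
  z ℚ.* 1ℚ                                          ≡⟨ ℚP.*-identityʳ z ⟩
  z                                                 ∎
  where open ≡-Reasoning

sign : ℕ → ℚ
sign m = ℤ→ℚ ((ℤ.- (+ 1)) ℤ.^ m)

±1 : ∀ m → (ℤ.- (+ 1)) ℤ.^ m ≡ + 1 ⊎ (ℤ.- (+ 1)) ℤ.^ m ≡ ℤ.- (+ 1)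
±1 ℕ.zero = inj₁ refl
±1 (suc m) with ±1 m
... | inj₁ eq = inj₂ (cong (ℤ.- (+ 1) ℤ.*_) eq)
... | inj₂ eq = inj₁ (cong (ℤ.- (+ 1) ℤ.*_) eq)

sign-suc : ∀ m → sign (suc m) ≡ ℚ.- 1ℚ ℚ.* sign m
sign-suc m = ℤ→ℚ-* (ℤ.- (+ 1)) ((ℤ.- (+ 1)) ℤ.^ m)

sign-cancel : ∀ m x → sign m ℚ.* x ≡ 0ℚ → x ≡ 0ℚ
sign-cancel m x sx≡0 = begin
  x                          ≡⟨ sym (ℚP.*-identityˡ x) ⟩
  1ℚ ℚ.* x                   ≡⟨ cong (ℚ._* x) (sym (sign² m)) ⟩
  (sign m ℚ.* sign m) ℚ.* x  ≡⟨ ℚP.*-assoc (sign m) (sign m) x ⟩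
  sign m ℚ.* (sign m ℚ.* x)  ≡⟨ cong (sign m ℚ.*_) sx≡0 ⟩
  sign m ℚ.* 0ℚ              ≡⟨ ℚP.*-zeroʳ (sign m) ⟩
  0ℚ                         ∎
  where
  open ≡-Reasoning
  sign² : ∀ m → sign m ℚ.* sign m ≡ 1ℚ
  sign² m with (ℤ.- (+ 1)) ℤ.^ m | ±1 m
  ... | _ | inj₁ refl = refl
  ... | _ | inj₂ refl = refl

factor-degree : ∀ {n} (i : Fin n) m → WeightAtMost (λ e → lookup e (fsuc i)) m ((T -P X i) ^P m)
factor-degree i ℕ.zero  = ℕP.≤-reflexive (lookup-replicate (fsuc i) 0) ∷ []
factor-degree i (suc m) = All.++⁺
  (All.map (λ e≤m → ℕP.m≤n⇒m≤1+n e≤m) (weightAtMost-map-*ₜ (1ℚ , unit fzero) (unit-other fzero (fsuc i) (λ ())) (factor-degree i m)))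
  (All.++⁺ (weightAtMost-map-*ₜ (ℚ.- 1ℚ , unit (fsuc i)) (unit-self (fsuc i)) (factor-degree i m)) [])
  where open ExponentOf (fsuc i)

factor-top : ∀ {n} (i : Fin n) m → coeffIn (fsuc i) m ((T -P X i) ^P m) ≡ const (sign m)
factor-top i ℕ.zero  = trans (cong (_++ []) (coeffInₜ-yes (fsuc i) 0 1ℚ zeros zeros₀))
                              (cong (λ v → (1ℚ , v) ∷ []) (setAt-lookup (fsuc i) zeros zeros₀))
  where zeros₀ = lookup-replicate (fsuc i) 0
factor-top {n} i (suc m) = begin
  coeffIn x (suc m) (List.map (t *ₜ_) R ++ List.map (−x *ₜ_) R ++ [])
    ≡⟨ trans (coeffIn-++ x (suc m) (List.map (t *ₜ_) R) _) (cong (coeffIn x (suc m) (List.map (t *ₜ_) R) ++_) (coeffIn-++ x (suc m) (List.map (−x *ₜ_) R) [])) ⟩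
  coeffIn x (suc m) (List.map (t *ₜ_) R) ++ coeffIn x (suc m) (List.map (−x *ₜ_) R) ++ []
    ≡⟨ cong₂ (λ u v → u ++ v ++ []) (coeffIn-above x (weightAtMost-map-*ₜ t (unit-other fzero x (λ ())) (factor-degree i m)) (ℕP.n<1+n m))
                                      (coeffIn-map-*ₜ x 1 m (ℚ.- 1ℚ) (unit x) (unit-self x) R) ⟩
  List.map ((ℚ.- 1ℚ , setAt x 0 (unit x)) *ₜ_) (coeffIn x m R) ++ []
    ≡⟨ cong (λ z → List.map ((ℚ.- 1ℚ , setAt x 0 (unit x)) *ₜ_) z ++ []) (factor-top i m) ⟩
  (ℚ.- 1ℚ ℚ.* sign m , setAt x 0 (unit x) ⊕ zeros) ∷ []
    ≡⟨ cong₂ (λ c v → (c , v) ∷ []) (sym (sign-suc m)) (trans (cong (_⊕ zeros) reset-unit) (⊕-identityˡ zeros)) ⟩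
  const (sign (suc m)) ∎
  where
  open ≡-Reasoning
  open ExponentOf (fsuc i)
  x = fsuc i
  R = (T -P X i) ^P m
  t −x : Term (suc n)
  t  = (1ℚ , unit fzero)
  −x = (ℚ.- 1ℚ , unit x)
  reset-unit : setAt x 0 (unit x) ≡ zeros
  reset-unit = vec-ext λ j → pointwise j (x ≟F j)
    where
    pointwise : ∀ j → Dec (x ≡ j) → lookup (setAt x 0 (unit x)) j ≡ lookup zeros j
    pointwise j (yes refl) = trans (lookup∘updateAt x (unit x)) (sym (lookup-replicate x 0))
    pointwise j (no x≢j)   = trans (lookup-setAt-other x j 0 (unit x) x≢j) (trans (unit-other x j x≢j) (sym (lookup-replicate j 0)))

without : ∀ {n} → Fin n → List (Fin n) → List (Fin n)
without i = filterᵇ (λ j → not (does (j ≟F i)))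

without-self : ∀ {n} (i : Fin n) J → without i (i ∷ J) ≡ without i J
without-self i J with i ≟F i
... | yes _   = refl
... | no  i≢i = contradiction refl i≢i

without-other : ∀ {n} (i j : Fin n) J → ¬ (j ≡ i) → without i (j ∷ J) ≡ j ∷ without i J
without-other i j J j≢i with j ≟F i
... | yes j≡i = contradiction j≡i j≢i
... | no  _   = refl

without-absent : ∀ {n} (i : Fin n) J → All (λ j → ¬ (j ≡ i)) J → without i J ≡ J
without-absent i []      []            = refl
without-absent i (j ∷ J) (j≢i ∷ J∌i) = trans (without-other i j J j≢i) (cong (j ∷_) (without-absent i J J∌i))

module SingleFactor {n} (i : Fin n) (F : Fin n → Poly (suc n))
                    (others-free : ∀ j → ¬ (j ≡ i) → Free (fsuc i) (F j)) where

  product-free : ∀ J → All (λ j → ¬ (j ≡ i)) J → Free (fsuc i) (prodP (List.map F J))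
  product-free J J∌i = weight-prodP (List.map F J) (All.map⁺ (All.map (λ {j} → others-free j) J∌i))
    where open ExponentOf (fsuc i)

  coeffIn-prodP : ∀ J → Unique J → i ∈ J → ∀ d →
    coeffIn (fsuc i) d (prodP (List.map F J)) ↭ coeffIn (fsuc i) d (F i) *P prodP (List.map F (without i J))
  coeffIn-prodP (.i ∷ J) (J∌i ∷ _) (here refl) d = ↭-trans (coeffIn-*P-freeʳ (fsuc i) d (product-free J J∌i′) (F i))
    (↭-reflexive (cong (λ J′ → coeffIn (fsuc i) d (F i) *P prodP (List.map F J′))
                       (sym (trans (without-self i J) (without-absent i J J∌i′)))))
    where J∌i′ = All.map (λ i≢j j≡i → i≢j (sym j≡i)) J∌i
  coeffIn-prodP (j ∷ J) (j∉J ∷ unique) (there i∈J) d = begin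
    coeffIn (fsuc i) d (F j *P prodP (List.map F J))
      ≡⟨ coeffIn-*P-free (fsuc i) d (others-free j j≢i) (prodP (List.map F J)) ⟩
    F j *P coeffIn (fsuc i) d (prodP (List.map F J))
      ↭⟨ *P-congʳ (F j) (coeffIn-prodP J unique i∈J d) ⟩
    F j *P (coeffIn (fsuc i) d (F i) *P prodP (List.map F (without i J)))
      ↭⟨ *P-leftComm (F j) (coeffIn (fsuc i) d (F i)) _ ⟩
    coeffIn (fsuc i) d (F i) *P prodP (List.map F (j ∷ without i J))
      ≡⟨ cong (λ J′ → coeffIn (fsuc i) d (F i) *P prodP (List.map F J′)) (sym (without-other i j J j≢i)) ⟩
    coeffIn (fsuc i) d (F i) *P prodP (List.map F (without i (j ∷ J))) ∎
    where
    open PermutationReasoning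
    j≢i : ¬ (j ≡ i)
    j≢i j≡i = All.lookup j∉J i∈J j≡i

integral-const : ∀ {n} (a b : Fin n) s Y → integral a b (const s *P Y) ≡ const s *P integral a b Y
integral-const a b s Y = trans (cong (integral a b) (LP.++-identityʳ (List.map ((s , zeros) *ₜ_) Y)))
  (trans (scaled Y) (sym (LP.++-identityʳ (List.map ((s , zeros) *ₜ_) (integral a b Y)))))
  where
  scaled : ∀ Y → integral a b (List.map ((s , zeros) *ₜ_) Y) ≡ List.map ((s , zeros) *ₜ_) (integral a b Y)
  scaled []                  = refl
  scaled ((c , k ∷ e) ∷ Y) = cong₂ _∷_
    (cong₂ _,_ (ℚP.*-assoc s c _) (trans (cong (addAt b (suc k)) (⊕-identityˡ e)) (sym (⊕-identityˡ _))))
    (cong₂ _∷_ (cong₂ _,_ (trans (cong ℚ.-_ (ℚP.*-assoc s c _)) (ℚP.neg-distribʳ-* s _))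
                          (trans (cong (addAt a (suc k)) (⊕-identityˡ e)) (sym (⊕-identityˡ _))))
               (scaled Y))

coeff-const-*P : ∀ {n} s (R : Poly n) e → coeff (const s *P R) e ≡ s ℚ.* coeff R e
coeff-const-*P s R e = trans (cong (λ z → coeff z e) (LP.++-identityʳ (List.map ((s , zeros) *ₜ_) R))) (scaled R)
  where
  scaledₜ : ∀ t → coeffₜ ((s , zeros) *ₜ t) e ≡ s ℚ.* coeffₜ t e
  scaledₜ (c , e′) rewrite ⊕-identityˡ e′ with ≡-dec ℕ._≟_ e′ e
  ... | yes _ = refl
  ... | no  _ = sym (ℚP.*-zeroʳ s)
  scaled : ∀ R → coeff (List.map ((s , zeros) *ₜ_) R) e ≡ s ℚ.* coeff R e
  scaled []      = sym (ℚP.*-zeroʳ s)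
  scaled (t ∷ R) = begin
    coeff ((s , zeros) *ₜ t ∷ List.map ((s , zeros) *ₜ_) R) e       ≡⟨ coeff-∷ ((s , zeros) *ₜ t) (List.map ((s , zeros) *ₜ_) R) e ⟩
    coeffₜ ((s , zeros) *ₜ t) e ℚ.+ coeff (List.map ((s , zeros) *ₜ_) R) e ≡⟨ cong₂ ℚ._+_ (scaledₜ t) (scaled R) ⟩
    s ℚ.* coeffₜ t e ℚ.+ s ℚ.* coeff R e                            ≡⟨ sym (ℚP.*-distribˡ-+ s (coeffₜ t e) (coeff R e)) ⟩
    s ℚ.* (coeffₜ t e ℚ.+ coeff R e)                                ≡⟨ cong (s ℚ.*_) (sym (coeff-∷ t R e)) ⟩
    s ℚ.* coeff (t ∷ R) e                                           ∎
    where open ≡-Reasoning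

-- For a variable x other than x₁, x₂ only the factor
-- (t - x)^m of the integrand involves x, so the coefficient of x^d in Q is
-- the integral of the coefficient of x^d in (t - x)^m times the other
-- factors: zero for d > m and (-1)^m · Qexcept for d = m.
module OtherVariable (k m l : ℕ) (j : Fin k) where

  x : Fin (2 ℕ.+ k)
  x = fsuc (fsuc j)

  factor : Fin (2 ℕ.+ k) → Poly (suc (2 ℕ.+ k))
  factor y = (T -P X y) ^P m

  others-free : ∀ y → ¬ (y ≡ x) → Free (fsuc x) (factor y)
  others-free y y≢x = weight-^P m (weight-++ (free-var fzero (λ ())) (weight--P (free-var (fsuc y) (λ eq → y≢x (Finₚ.suc-injective eq)))))
    where open ExponentOf (fsuc x)

  open SingleFactor x factor others-free

  all : List (Fin (2 ℕ.+ k))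
  all = allFin (2 ℕ.+ k)

  coeffIn-Q : ∀ d → coeffIn x d (Q k m l) ↭
              integral i₁ i₂ (coeffIn (fsuc x) d (factor x) *P integrand l m (without x all))
  coeffIn-Q d = begin
    coeffIn x d (integral i₁ i₂ (T ^P l *P prodP (List.map factor all)))
      ≡⟨ coeffIn-integral x i₁ i₂ d (λ ()) (λ ()) (T ^P l *P prodP (List.map factor all)) ⟩
    integral i₁ i₂ (coeffIn (fsuc x) d (T ^P l *P prodP (List.map factor all)))
      ≡⟨ cong (integral i₁ i₂) (coeffIn-*P-free (fsuc x) d (weight-^P l (free-var fzero (λ ()))) (prodP (List.map factor all))) ⟩
    integral i₁ i₂ (T ^P l *P coeffIn (fsuc x) d (prodP (List.map factor all)))
      ↭⟨ integral-↭ i₁ i₂ (*P-congʳ (T ^P l) (coeffIn-prodP all (Unique.allFin⁺ _) (∈-allFin x) d)) ⟩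
    integral i₁ i₂ (T ^P l *P (C *P prodP (List.map factor (without x all))))
      ↭⟨ integral-↭ i₁ i₂ (*P-leftComm (T ^P l) C (prodP (List.map factor (without x all)))) ⟩
    integral i₁ i₂ (C *P integrand l m (without x all)) ∎
    where
    open PermutationReasoning
    open ExponentOf (fsuc x)
    C = coeffIn (fsuc x) d (factor x)

  top-coefficient : coeffIn x m (Q k m l) ≈ const (sign m) *P Qexcept k m l x
  top-coefficient e = trans (coeff-↭ (coeffIn-Q m) e) (cong (λ z → coeff z e) (trans
    (cong (λ C → integral i₁ i₂ (C *P integrand l m (without x all))) (factor-top x m))
    (integral-const i₁ i₂ (sign m) (integrand l m (without x all)))))

  above-degree : ∀ d → m ℕ.< d → coeffIn x d (Q k m l) ≈ 0P
  above-degree d m<d e = trans (coeff-↭ (coeffIn-Q d) e) (cong (λ z → coeff z e)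
    (cong (λ C → integral i₁ i₂ (C *P integrand l m (without x all))) (coeffIn-above (fsuc x) (factor-degree x m) m<d)))

  top-nonzero : ¬ (Qexcept k m l x ≈ 0P) → ¬ (coeffIn x m (Q k m l) ≈ 0P)
  top-nonzero Qexcept≢0 top≈0 = Qexcept≢0 λ e → sign-cancel m (coeff (Qexcept k m l x) e)
    (trans (sym (coeff-const-*P (sign m) (Qexcept k m l x) e)) (trans (sym (top-coefficient e)) (top≈0 e)))

-- The Beta integral B(a, m) = ∫₀¹ t^a (t - 1)^m dt satisfies
--   B(a, 0) = 1/(a+1)   and   B(a, m+1) = B(a+1, m) - B(a, m),
-- and these recursions alone force B(a, m) (a+1)(a+2)⋯(a+m+1) = (-1)^m m!.

rising : ℕ → ℕ → ℕ
rising a ℕ.zero  = suc a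
rising a (suc m) = suc a ℕ.* rising (suc a) m

rising-snoc : ∀ a m → rising a (suc m) ≡ rising a m ℕ.* suc (suc (a ℕ.+ m))
rising-snoc a ℕ.zero  = cong (λ z → suc a ℕ.* suc (suc z)) (sym (ℕP.+-identityʳ a))
rising-snoc a (suc m) = begin
  suc a ℕ.* rising (suc a) (suc m)                        ≡⟨ cong (suc a ℕ.*_) (rising-snoc (suc a) m) ⟩
  suc a ℕ.* (rising (suc a) m ℕ.* suc (suc (suc a ℕ.+ m))) ≡⟨ sym (ℕP.*-assoc (suc a) (rising (suc a) m) _) ⟩
  rising a (suc m) ℕ.* suc (suc (suc a ℕ.+ m))            ≡⟨ cong (λ z → rising a (suc m) ℕ.* suc (suc z)) (sym (ℕP.+-suc a m)) ⟩
  rising a (suc m) ℕ.* suc (suc (a ℕ.+ suc m))            ∎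
  where open ≡-Reasoning

rising-positive : ∀ a m → Σ[ p ∈ ℕ ] rising a m ≡ suc p
rising-positive a ℕ.zero    = a , refl
rising-positive a (suc m) with rising-positive (suc a) m
... | p , eq = p ℕ.+ a ℕ.* suc p , cong (suc a ℕ.*_) eq

betaNumerator : ℕ → ℚ
betaNumerator m = ℤ→ℚ ((ℤ.- (+ 1)) ℤ.^ m ℤ.* + (m !))

betaNumerator-nonzero : ∀ m → ¬ (betaNumerator m ≡ 0ℚ)
betaNumerator-nonzero m eq = [ sign≢0 (±1 m) , m!≢0 ] (ℤP.i*j≡0⇒i≡0∨j≡0 s numerator≡0)
  where
  s = (ℤ.- (+ 1)) ℤ.^ m
  numerator≡0 : s ℤ.* + (m !) ≡ + 0
  numerator≡0 = trans (sym (cong ℚ.↥_ (ℤ→ℚ-mkℚ (s ℤ.* + (m !))))) (cong ℚ.↥_ eq)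
  sign≢0 : s ≡ + 1 ⊎ s ≡ ℤ.- (+ 1) → ¬ (s ≡ + 0)
  sign≢0 (inj₁ s≡1)  s≡0 = case trans (sym s≡1) s≡0 of λ ()
  sign≢0 (inj₂ s≡-1) s≡0 = case trans (sym s≡-1) s≡0 of λ ()
  m!≢0 : ¬ (+ (m !) ≡ + 0)
  m!≢0 m!≡0 = ℕP.<-irrefl (sym (ℤP.+-injective m!≡0)) (ℕP.1≤n! m)

module BetaRecursion (B : ℕ → ℕ → ℚ)
                     (B-zero : ∀ a → B a 0 ≡ 1ℚ ÷ℕ suc a)
                     (B-suc : ∀ a m → B a (suc m) ≡ B (suc a) m ℚ.+ ℚ.- B a m) where

  numerator-step : ∀ m a → betaNumerator m ℚ.* ℤ→ℚ (+ suc a) ℚ.+ ℚ.- (betaNumerator m ℚ.* ℤ→ℚ (+ suc (suc (a ℕ.+ m))))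
                           ≡ betaNumerator (suc m)
  numerator-step m a = begin
    ℤ→ℚ x ℚ.* ℤ→ℚ (+ suc a) ℚ.+ ℚ.- (ℤ→ℚ x ℚ.* ℤ→ℚ (+ suc (suc (a ℕ.+ m))))
      ≡⟨ sym (cong₂ ℚ._+_ (ℤ→ℚ-* x (+ suc a)) (trans (ℤ→ℚ-neg (x ℤ.* + suc (suc (a ℕ.+ m)))) (cong ℚ.-_ (ℤ→ℚ-* x (+ suc (suc (a ℕ.+ m))))))) ⟩
    ℤ→ℚ (x ℤ.* + suc a) ℚ.+ ℤ→ℚ (ℤ.- (x ℤ.* + suc (suc (a ℕ.+ m))))
      ≡⟨ sym (ℤ→ℚ-+ (x ℤ.* + suc a) _) ⟩
    ℤ→ℚ (x ℤ.* + suc a ℤ.+ ℤ.- (x ℤ.* + suc (suc (a ℕ.+ m))))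
      ≡⟨ cong (λ z → ℤ→ℚ (x ℤ.* + suc a ℤ.+ ℤ.- (x ℤ.* z))) (trans (cong (λ z → + suc z) (sym (ℕP.+-suc a m))) (ℤP.pos-+ (suc a) (suc m))) ⟩
    ℤ→ℚ (s ℤ.* f ℤ.* + suc a ℤ.+ ℤ.- (s ℤ.* f ℤ.* (+ suc a ℤ.+ + suc m)))
      ≡⟨ cong ℤ→ℚ (difference s f (+ suc a) (+ suc m)) ⟩
    ℤ→ℚ (ℤ.- (+ 1) ℤ.* s ℤ.* (+ suc m ℤ.* f))
      ≡⟨ cong (λ z → ℤ→ℚ (ℤ.- (+ 1) ℤ.* s ℤ.* z)) (sym (ℤP.pos-* (suc m) (m !))) ⟩
    betaNumerator (suc m) ∎
    where
    open ≡-Reasoning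
    s = (ℤ.- (+ 1)) ℤ.^ m
    f = + (m !)
    x = s ℤ.* f
    difference : ∀ (s f A M : ℤ) → s ℤ.* f ℤ.* A ℤ.+ ℤ.- (s ℤ.* f ℤ.* (A ℤ.+ M)) ≡ ℤ.- (+ 1) ℤ.* s ℤ.* (M ℤ.* f)
    difference = solve 4 (λ s f A M → s :* f :* A :+ :- (s :* f :* (A :+ M)) := :- con (+ 1) :* s :* (M :* f)) refl
      where open ℤ-Solver

  closed-form : ∀ m a → B a m ℚ.* ℤ→ℚ (+ rising a m) ≡ betaNumerator m
  closed-form ℕ.zero  a = trans (cong (ℚ._* ℤ→ℚ (+ suc a)) (B-zero a)) (÷ℕ-cancel 1ℚ a)
  closed-form (suc m) a = begin
    B a (suc m) ℚ.* N                                 ≡⟨ cong (ℚ._* N) (B-suc a m) ⟩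
    (B (suc a) m ℚ.+ ℚ.- B a m) ℚ.* N                 ≡⟨ ℚP.*-distribʳ-+ N (B (suc a) m) (ℚ.- B a m) ⟩
    B (suc a) m ℚ.* N ℚ.+ (ℚ.- B a m) ℚ.* N           ≡⟨ cong₂ ℚ._+_ shifted (trans (sym (ℚP.neg-distribˡ-* (B a m) N)) (cong ℚ.-_ extended)) ⟩
    betaNumerator m ℚ.* A ℚ.+ ℚ.- (betaNumerator m ℚ.* C) ≡⟨ numerator-step m a ⟩
    betaNumerator (suc m)                             ∎
    where
    open ≡-Reasoning
    N = ℤ→ℚ (+ rising a (suc m))
    A = ℤ→ℚ (+ suc a)
    C = ℤ→ℚ (+ suc (suc (a ℕ.+ m)))
    -- N = (a+1) · rising (a+1) m
    shifted : B (suc a) m ℚ.* N ≡ betaNumerator m ℚ.* A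
    shifted = begin
      B (suc a) m ℚ.* N                                 ≡⟨ cong (B (suc a) m ℚ.*_) (trans (cong ℤ→ℚ (ℤP.pos-* (suc a) (rising (suc a) m))) (trans (ℤ→ℚ-* (+ suc a) (+ rising (suc a) m)) (ℚP.*-comm A _))) ⟩
      B (suc a) m ℚ.* (ℤ→ℚ (+ rising (suc a) m) ℚ.* A) ≡⟨ sym (ℚP.*-assoc (B (suc a) m) _ A) ⟩
      B (suc a) m ℚ.* ℤ→ℚ (+ rising (suc a) m) ℚ.* A   ≡⟨ cong (ℚ._* A) (closed-form m (suc a)) ⟩
      betaNumerator m ℚ.* A                             ∎
    -- N = rising a m · (a+m+2)
    extended : B a m ℚ.* N ≡ betaNumerator m ℚ.* C
    extended = begin
      B a m ℚ.* N                                       ≡⟨ cong (B a m ℚ.*_) (trans (cong ℤ→ℚ (trans (cong +_ (rising-snoc a m)) (ℤP.pos-* (rising a m) _))) (ℤ→ℚ-* (+ rising a m) _)) ⟩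
      B a m ℚ.* (ℤ→ℚ (+ rising a m) ℚ.* C)             ≡⟨ sym (ℚP.*-assoc (B a m) _ C) ⟩
      B a m ℚ.* ℤ→ℚ (+ rising a m) ℚ.* C               ≡⟨ cong (ℚ._* C) (closed-form m a) ⟩
      betaNumerator m ℚ.* C                             ∎

  nonzero : ∀ a m → ¬ (B a m ≡ 0ℚ)
  nonzero a m B≡0 = betaNumerator-nonzero m (begin
    betaNumerator m                       ≡⟨ sym (closed-form m a) ⟩
    B a m ℚ.* ℤ→ℚ (+ rising a m)          ≡⟨ cong (ℚ._* ℤ→ℚ (+ rising a m)) B≡0 ⟩
    0ℚ ℚ.* ℤ→ℚ (+ rising a m)             ≡⟨ ℚP.*-zeroˡ (ℤ→ℚ (+ rising a m)) ⟩
    0ℚ                                    ∎)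
    where open ≡-Reasoning

-- Write exponent vectors of the integrand as
-- (t, x₁, x₂, …).  Terms of Q of total degree D containing x₁^D come from
-- the lower bound of integration only, from integrand terms free of x₂, …:
-- the coefficient is -∫₀¹ P(t, 1, 0, …, 0) dt.  We compute this "corner
-- integral" on the integrand after discarding all terms involving x₂, …,
-- an operation compatible with products.
module Corner (k : ℕ) where

  others : Exp (3 ℕ.+ k) → Vec ℕ (suc k)
  others (_ ∷ _ ∷ r) = r

  Pure : Term (3 ℕ.+ k) → Set
  Pure (_ , e) = others e ≡ zeros

  pure? : (a : Term (3 ℕ.+ k)) → Dec (Pure a)
  pure? (_ , e) = ≡-dec ℕ._≟_ (others e) zeros

  dropOthers : Poly (3 ℕ.+ k) → Poly (3 ℕ.+ k)
  dropOthers = List.filter pure?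

  pure-*ₜ : ∀ a b → Pure (a *ₜ b) ⇔ (Pure a × Pure b)
  pure-*ₜ (c , _ ∷ _ ∷ r) (d , _ ∷ _ ∷ s) = mk⇔ (⊕≡zeros r s) (λ { (refl , refl) → ⊕-identityˡ zeros })

  dropOthers-map-*ₜ : ∀ a → Pure a → ∀ R → dropOthers (List.map (a *ₜ_) R) ≡ List.map (a *ₜ_) (dropOthers R)
  dropOthers-map-*ₜ a pa []      = refl
  dropOthers-map-*ₜ a pa (b ∷ R) with pure? b
  ... | yes pb = trans (LP.filter-accept pure? {x = a *ₜ b} {xs = List.map (a *ₜ_) R} (Equivalence.from (pure-*ₜ a b) (pa , pb)))
                       (cong (a *ₜ b ∷_) (dropOthers-map-*ₜ a pa R))
  ... | no ¬pb = trans (LP.filter-reject pure? {x = a *ₜ b} {xs = List.map (a *ₜ_) R} (λ pab → ¬pb (proj₂ (Equivalence.to (pure-*ₜ a b) pab))))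
                       (dropOthers-map-*ₜ a pa R)

  dropOthers-*P : ∀ p q → dropOthers (p *P q) ≡ dropOthers p *P dropOthers q
  dropOthers-*P []      q = refl
  dropOthers-*P (a ∷ p) q with pure? a
  ... | yes pa = trans (LP.filter-++ pure? (List.map (a *ₜ_) q) (p *P q))
                       (cong₂ _++_ (dropOthers-map-*ₜ a pa q) (dropOthers-*P p q))
  ... | no ¬pa = trans (LP.filter-++ pure? (List.map (a *ₜ_) q) (p *P q))
                       (cong₂ _++_ (LP.filter-none pure? (All.map⁺ (All.universal impure q))) (dropOthers-*P p q))
    where
    impure : ∀ b → ¬ Pure (a *ₜ b)
    impure b pab = ¬pa (proj₁ (Equivalence.to (pure-*ₜ a b) pab))

  dropOthers-one : dropOthers (const 1ℚ) ≡ const 1ℚ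
  dropOthers-one = LP.filter-accept pure? refl

  dropOthers-^P : ∀ {F G} → dropOthers F ≡ G → ∀ m → dropOthers (F ^P m) ≡ G ^P m
  dropOthers-^P F↦G ℕ.zero  = dropOthers-one
  dropOthers-^P {F} F↦G (suc m) = trans (dropOthers-*P F (F ^P m)) (cong₂ _*P_ F↦G (dropOthers-^P F↦G m))

  dropOthers-prodP : ∀ Fs → dropOthers (prodP Fs) ≡ prodP (List.map dropOthers Fs)
  dropOthers-prodP []       = dropOthers-one
  dropOthers-prodP (F ∷ Fs) = trans (dropOthers-*P F (prodP Fs)) (cong (dropOthers F *P_) (dropOthers-prodP Fs))

  -- ∫₀¹ t^a P(t, 1, 0, …, 0) dt, termwise: c t^j x₁^i contributes
  -- c/(a+j+1), terms involving x₂, … contribute nothing.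
  cornerₜ : ℕ → Term (3 ℕ.+ k) → ℚ
  cornerₜ a (c , j ∷ _ ∷ r) = coeffₜ (c ÷ℕ suc (a ℕ.+ j) , r) zeros

  corner : ℕ → Poly (3 ℕ.+ k) → ℚ
  corner a = Σₜ (cornerₜ a)

  corner-dropOthers : ∀ a P → corner a (dropOthers P) ≡ corner a P
  corner-dropOthers a []                        = refl
  corner-dropOthers a (t@(c , j ∷ _ ∷ r) ∷ P) = case-pure (pure? t)
    where
    case-pure : Dec (Pure t) → corner a (dropOthers (t ∷ P)) ≡ corner a (t ∷ P)
    case-pure (yes pt)  = trans (cong (corner a) (LP.filter-accept pure? {x = t} {xs = P} pt))
                                (cong (cornerₜ a t ℚ.+_) (corner-dropOthers a P))
    case-pure (no r≢0) = trans (cong (corner a) (LP.filter-reject pure? {x = t} {xs = P} r≢0)) (trans (corner-dropOthers a P)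
      (sym (trans (cong (ℚ._+ corner a P) (coeffₜ-≢ (c ÷ℕ suc (a ℕ.+ j)) r zeros r≢0)) (ℚP.+-identityˡ (corner a P)))))

  tPower : ℕ → Poly (3 ℕ.+ k)
  tPower r = (1ℚ , r ∷ zeros) ∷ []

  T^P≡tPower : ∀ r → T ^P r ≡ tPower r
  T^P≡tPower ℕ.zero  = refl
  T^P≡tPower (suc r) = trans (cong (T *P_) (T^P≡tPower r))
    (cong (λ v → (1ℚ ℚ.* 1ℚ , suc r ∷ v) ∷ []) (trans (cong (_⊕ zeros) (tabulate-zero _)) (⊕-identityˡ zeros)))

  tPower-*P : ∀ a b → tPower a *P tPower b ≡ tPower (a ℕ.+ b)
  tPower-*P a b = cong (λ v → (1ℚ , a ℕ.+ b ∷ v) ∷ []) (⊕-identityˡ zeros)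

  corner-tPower : ∀ a R → corner 0 (tPower a *P R) ≡ corner a R
  corner-tPower a R = trans (cong (corner 0) (LP.++-identityʳ (List.map ((1ℚ , a ∷ zeros) *ₜ_) R))) (shifted R)
    where
    shifted : ∀ R → corner 0 (List.map ((1ℚ , a ∷ zeros) *ₜ_) R) ≡ corner a R
    shifted []                  = refl
    shifted ((c , j ∷ i ∷ r) ∷ R) = cong₂ ℚ._+_
      (cong₂ (λ x v → coeffₜ (x ÷ℕ suc (a ℕ.+ j) , v) zeros) (ℚP.*-identityˡ c) (⊕-identityˡ r)) (shifted R)

  dropOthers-T : dropOthers T ≡ T
  dropOthers-T = LP.filter-accept pure? {x = t} {xs = []} (tabulate-zero _)
    where t = (1ℚ , unit fzero)

  dropOthers-t-x₁ : dropOthers (T -P X fzero) ≡ T -P X fzero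
  dropOthers-t-x₁ = trans (LP.filter-accept pure? {x = t} {xs = −x₁ ∷ []} (tabulate-zero _))
                          (cong (t ∷_) (LP.filter-accept pure? {x = −x₁} {xs = []} (tabulate-zero _)))
    where
    t −x₁ : Term (3 ℕ.+ k)
    t   = (1ℚ , unit fzero)
    −x₁ = (ℚ.- 1ℚ , unit (fsuc fzero))

  dropOthers-t-x : ∀ j → dropOthers (T -P X (fsuc j)) ≡ T
  dropOthers-t-x j = trans (LP.filter-accept pure? {x = t} {xs = −x ∷ []} (tabulate-zero _))
                           (cong (t ∷_) (LP.filter-reject pure? {x = −x} {xs = []} involves-x))
    where
    t −x : Term (3 ℕ.+ k)
    t  = (1ℚ , unit fzero)
    −x = (ℚ.- 1ℚ , unit (fsuc (fsuc j)))
    involves-x : ¬ Pure −x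
    involves-x unitⱼ≡0 = case trans (sym (unit-self j)) (trans (cong (λ v → lookup v j) unitⱼ≡0) (lookup-replicate j 0)) of λ ()

  beta : ℕ → ℕ → ℚ
  beta a m = corner a ((T -P X fzero) ^P m)

  beta-zero : ∀ a → beta a 0 ≡ 1ℚ ÷ℕ suc a
  beta-zero a = trans (ℚP.+-identityʳ (cornerₜ a (1ℚ , zeros))) (trans (coeffₜ-self (1ℚ ÷ℕ suc (a ℕ.+ 0)) (zeros {suc k}))
                                                (cong (λ z → 1ℚ ÷ℕ suc z) (ℕP.+-identityʳ a)))

  beta-suc : ∀ a m → beta a (suc m) ≡ beta (suc a) m ℚ.+ ℚ.- beta a m
  beta-suc a m = begin
    corner a (List.map (t *ₜ_) R ++ List.map (−x₁ *ₜ_) R ++ [])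
      ≡⟨ trans (Σₜ-++ (cornerₜ a) (List.map (t *ₜ_) R) _) (cong (corner a (List.map (t *ₜ_) R) ℚ.+_) (trans (Σₜ-++ (cornerₜ a) (List.map (−x₁ *ₜ_) R) []) (ℚP.+-identityʳ _))) ⟩
    corner a (List.map (t *ₜ_) R) ℚ.+ corner a (List.map (−x₁ *ₜ_) R)
      ≡⟨ cong₂ ℚ._+_ (Σₜ-map (cornerₜ a) (cornerₜ (suc a)) by-t R)
                    (trans (Σₜ-map (cornerₜ a) (λ u → ℚ.- cornerₜ a u) by-−x₁ R) (Σₜ-neg (cornerₜ a) R)) ⟩
    beta (suc a) m ℚ.+ ℚ.- beta a m ∎
    where
    open ≡-Reasoning
    R = (T -P X fzero) ^P m
    t −x₁ : Term (3 ℕ.+ k)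
    t   = (1ℚ , unit fzero)
    −x₁ = (ℚ.- 1ℚ , unit (fsuc fzero))
    by-t : ∀ u → cornerₜ a (t *ₜ u) ≡ cornerₜ (suc a) u
    by-t (c , j ∷ i ∷ r) = cong₂ (λ x v → coeffₜ (x , v) zeros)
      (cong₂ _÷ℕ_ (ℚP.*-identityˡ c) (cong suc (ℕP.+-suc a j)))
      (trans (cong (_⊕ r) (tabulate-zero _)) (⊕-identityˡ r))
    by-−x₁ : ∀ u → cornerₜ a (−x₁ *ₜ u) ≡ ℚ.- cornerₜ a u
    by-−x₁ (c , j ∷ i ∷ r) = trans (cong₂ (λ x v → coeffₜ (x , v) zeros)
      (trans (cong (_÷ℕ suc (a ℕ.+ j)) (trans (sym (ℚP.neg-distribˡ-* 1ℚ c)) (cong ℚ.-_ (ℚP.*-identityˡ c))))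
             (sym (ℚP.neg-distribˡ-* c _)))
      (trans (cong (_⊕ r) (tabulate-zero _)) (⊕-identityˡ r)))
      (coeffₜ-neg (c ÷ℕ suc (a ℕ.+ j)) r zeros)

  x₁^ : ℕ → Exp (2 ℕ.+ k)
  x₁^ D = D ∷ zeros

  coeff-x₁^-integral : ∀ d P → HasWeight sumℕ d P → coeff (integral i₁ i₂ P) (x₁^ (suc d)) ≡ ℚ.- corner 0 P
  coeff-x₁^-integral d []                              []       = refl
  coeff-x₁^-integral d (t@(c , j ∷ e₀ ∷ r₀ ∷ r) ∷ P) (w ∷ ws) = begin
    coeff (upper ∷ lower ∷ integral i₁ i₂ P) E
      ≡⟨ trans (coeff-∷ upper _ E) (cong (coeffₜ upper E ℚ.+_) (coeff-∷ lower _ E)) ⟩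
    coeffₜ upper E ℚ.+ (coeffₜ lower E ℚ.+ coeff (integral i₁ i₂ P) E)
      ≡⟨ cong₂ (λ u v → u ℚ.+ (v ℚ.+ coeff (integral i₁ i₂ P) E)) upper-vanishes
               (trans (coeffₜ-⇔ (ℚ.- c′) ((e₀ ℕ.+ suc j) ∷ r₀ ∷ r) E (r₀ ∷ r) zeros lower⇔pure) (coeffₜ-neg c′ (r₀ ∷ r) zeros)) ⟩
    0ℚ ℚ.+ (ℚ.- cornerₜ 0 t ℚ.+ coeff (integral i₁ i₂ P) E)
      ≡⟨ trans (ℚP.+-identityˡ _) (cong (ℚ.- cornerₜ 0 t ℚ.+_) (coeff-x₁^-integral d P ws)) ⟩
    ℚ.- cornerₜ 0 t ℚ.+ ℚ.- corner 0 P
      ≡⟨ sym (ℚP.neg-distrib-+ (cornerₜ 0 t) (corner 0 P)) ⟩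
    ℚ.- corner 0 (t ∷ P) ∎
    where
    open ≡-Reasoning
    E = x₁^ (suc d)
    c′ = c ÷ℕ suc j
    upper lower : Term (2 ℕ.+ k)
    upper = (c′ , e₀ ∷ (r₀ ℕ.+ suc j) ∷ r)
    lower = (ℚ.- c′ , (e₀ ℕ.+ suc j) ∷ r₀ ∷ r)
    -- the upper bound x₂ always occurs in the terms coming from it
    upper-vanishes : coeffₜ upper E ≡ 0ℚ
    upper-vanishes = coeffₜ-≢ c′ (e₀ ∷ (r₀ ℕ.+ suc j) ∷ r) E λ eq → case trans (sym (ℕP.+-suc r₀ j)) (cong (λ v → lookup v (fsuc fzero)) eq) of λ ()
    -- by homogeneity, a lower-bound term is a power of x₁ iff it has no x₂, …
    lower⇔pure : ((e₀ ℕ.+ suc j) ∷ r₀ ∷ r ≡ E) ⇔ (r₀ ∷ r ≡ zeros)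
    lower⇔pure = mk⇔ (cong Vec.tail) λ others≡0 → cong₂ _∷_ (begin
      e₀ ℕ.+ suc j                    ≡⟨ ℕP.+-suc e₀ j ⟩
      suc (e₀ ℕ.+ j)                  ≡⟨ cong suc (ℕP.+-comm e₀ j) ⟩
      suc (j ℕ.+ e₀)                  ≡⟨ cong (λ z → suc (j ℕ.+ z)) (sym (ℕP.+-identityʳ e₀)) ⟩
      suc (j ℕ.+ (e₀ ℕ.+ 0))          ≡⟨ cong (λ z → suc (j ℕ.+ (e₀ ℕ.+ z))) (sym (trans (cong sumℕ others≡0) (sumℕ-zeros (suc k)))) ⟩
      suc (j ℕ.+ (e₀ ℕ.+ sumℕ (r₀ ∷ r))) ≡⟨ cong suc w ⟩
      suc d                           ∎) others≡0

  dropOthers-factors : ∀ m (J : List (Fin (2 ℕ.+ k))) → All (λ j → ¬ (j ≡ fzero)) J →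
    dropOthers (prodP (List.map (λ j → (T -P X j) ^P m) J)) ≡ tPower (List.length J ℕ.* m)
  dropOthers-factors m []           []             = dropOthers-one
  dropOthers-factors m (fzero ∷ J)  (0≢0 ∷ _)      = contradiction refl 0≢0
  dropOthers-factors m (fsuc j ∷ J) (_ ∷ J∌0)      = begin
    dropOthers ((T -P X (fsuc j)) ^P m *P prodP (List.map (λ j → (T -P X j) ^P m) J))
      ≡⟨ dropOthers-*P ((T -P X (fsuc j)) ^P m) _ ⟩
    dropOthers ((T -P X (fsuc j)) ^P m) *P dropOthers (prodP (List.map (λ j → (T -P X j) ^P m) J))
      ≡⟨ cong₂ _*P_ (trans (dropOthers-^P (dropOthers-t-x j) m) (T^P≡tPower m)) (dropOthers-factors m J J∌0) ⟩
    tPower m *P tPower (List.length J ℕ.* m)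
      ≡⟨ tPower-*P m _ ⟩
    tPower (m ℕ.+ List.length J ℕ.* m) ∎
    where open ≡-Reasoning

  corner-integrand : ∀ l m (J : List (Fin (2 ℕ.+ k))) → All (λ j → ¬ (j ≡ fzero)) J →
                     corner 0 (integrand l m (fzero ∷ J)) ≡ beta (l ℕ.+ List.length J ℕ.* m) m
  corner-integrand l m J J∌0 = begin
    corner 0 (T ^P l *P (t-x₁^m *P rest))
      ≡⟨ sym (corner-dropOthers 0 (T ^P l *P (t-x₁^m *P rest))) ⟩
    corner 0 (dropOthers (T ^P l *P (t-x₁^m *P rest)))
      ≡⟨ cong (corner 0) (trans (dropOthers-*P (T ^P l) _) (cong₂ _*P_ (trans (dropOthers-^P dropOthers-T l) (T^P≡tPower l))
           (trans (dropOthers-*P t-x₁^m rest) (cong₂ _*P_ (dropOthers-^P dropOthers-t-x₁ m) (dropOthers-factors m J J∌0))))) ⟩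
    corner 0 (tPower l *P (t-x₁^m *P tPower c))
      ≡⟨ Σₜ-↭ (cornerₜ 0) (*P-congʳ (tPower l) (*P-comm t-x₁^m (tPower c))) ⟩
    corner 0 (tPower l *P (tPower c *P t-x₁^m))
      ≡⟨ cong (corner 0) (trans (sym (*P-assoc (tPower l) (tPower c) t-x₁^m)) (cong (_*P t-x₁^m) (tPower-*P l c))) ⟩
    corner 0 (tPower (l ℕ.+ c) *P t-x₁^m)
      ≡⟨ corner-tPower (l ℕ.+ c) t-x₁^m ⟩
    beta (l ℕ.+ c) m ∎
    where
    open ≡-Reasoning
    c = List.length J ℕ.* m
    t-x₁^m = (T -P X fzero) ^P m
    rest = prodP (List.map (λ j → (T -P X j) ^P m) J)

descending≡rising : ∀ a m → prodℕ (List.map (λ s → suc (a ℕ.+ m) ℕ.∸ s) (List.upTo (suc m))) ≡ rising a m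
descending≡rising a m = trans (cong prodℕ (LP.map-upTo (λ s → suc (a ℕ.+ m) ℕ.∸ s) (suc m))) (descending m)
  where
  descending : ∀ m → prodℕ (List.applyUpTo (λ s → suc (a ℕ.+ m) ℕ.∸ s) (suc m)) ≡ rising a m
  descending ℕ.zero  = trans (ℕP.*-identityʳ _) (cong suc (ℕP.+-identityʳ a))
  descending (suc m) = begin
    suc (a ℕ.+ suc m) ℕ.* prodℕ (List.applyUpTo (λ s → (a ℕ.+ suc m) ℕ.∸ s) (suc m))
      ≡⟨ cong (λ z → suc z ℕ.* prodℕ (List.applyUpTo (λ s → z ℕ.∸ s) (suc m))) (ℕP.+-suc a m) ⟩
    suc (suc (a ℕ.+ m)) ℕ.* prodℕ (List.applyUpTo (λ s → suc (a ℕ.+ m) ℕ.∸ s) (suc m))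
      ≡⟨ cong (suc (suc (a ℕ.+ m)) ℕ.*_) (descending m) ⟩
    suc (suc (a ℕ.+ m)) ℕ.* rising a m
      ≡⟨ trans (ℕP.*-comm _ (rising a m)) (sym (rising-snoc a m)) ⟩
    rising a (suc m) ∎
    where open ≡-Reasoning

module FirstVariable (k m l : ℕ) where
  open Corner k
  open BetaRecursion beta beta-zero beta-suc

  rest : List (Fin (2 ℕ.+ k))
  rest = List.tabulate fsuc

  rest∌x₁ : All (λ j → ¬ (j ≡ fzero)) rest
  rest∌x₁ = All.tabulate⁺ {f = fsuc} (λ _ ())

  coeff-x₁^ : ∀ J → All (λ j → ¬ (j ≡ fzero)) J →
    coeff (integral i₁ i₂ (integrand l m (fzero ∷ J))) (x₁^ (suc (l ℕ.+ List.length (fzero ∷ J) ℕ.* m)))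
      ≡ ℚ.- beta (l ℕ.+ List.length J ℕ.* m) m
  coeff-x₁^ J J∌x₁ = trans (coeff-x₁^-integral _ _ (homogeneous-integrand l m (fzero ∷ J)))
                           (cong ℚ.-_ (corner-integrand l m J J∌x₁))

  a : ℕ
  a = l ℕ.+ suc k ℕ.* m

  coeff-Q : coeff (Q k m l) (x₁^ (degree k m l)) ≡ ℚ.- beta a m
  coeff-Q = begin
    coeff (Q k m l) (x₁^ (degree k m l))                                 ≡⟨ cong (λ D → coeff (Q k m l) (x₁^ D)) (sym (degree-Q k m l)) ⟩
    coeff (Q k m l) (x₁^ (suc (l ℕ.+ List.length (allFin (2 ℕ.+ k)) ℕ.* m))) ≡⟨ coeff-x₁^ rest rest∌x₁ ⟩
    ℚ.- beta (l ℕ.+ List.length rest ℕ.* m) m                             ≡⟨ cong (λ z → ℚ.- beta (l ℕ.+ z ℕ.* m) m) (LP.length-tabulate {n = suc k} fsuc) ⟩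
    ℚ.- beta a m                                                          ∎
    where open ≡-Reasoning

  leading : leadCoeff₁ (2 ℕ.+ k) m l ≡ ℚ.- beta a m
  leading = trans (cong (ℤ→ℚ ((ℤ.- (+ 1)) ℤ.^ suc m ℤ.* + (m !)) ÷ℕ_) denominator)
                  (÷ℕ-unique (ℤ→ℚ ((ℤ.- (+ 1)) ℤ.^ suc m ℤ.* + (m !))) (ℚ.- beta a m) p (begin
    ℚ.- beta a m ℚ.* ℤ→ℚ (+ suc p)                 ≡⟨ sym (ℚP.neg-distribˡ-* (beta a m) _) ⟩
    ℚ.- (beta a m ℚ.* ℤ→ℚ (+ suc p))               ≡⟨ cong (λ z → ℚ.- (beta a m ℚ.* ℤ→ℚ (+ z))) (sym rising≡1+p) ⟩
    ℚ.- (beta a m ℚ.* ℤ→ℚ (+ rising a m))          ≡⟨ cong ℚ.-_ (closed-form m a) ⟩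
    ℚ.- betaNumerator m                            ≡⟨ sym (ℤ→ℚ-neg ((ℤ.- (+ 1)) ℤ.^ m ℤ.* + (m !))) ⟩
    ℤ→ℚ (ℤ.- ((ℤ.- (+ 1)) ℤ.^ m ℤ.* + (m !)))      ≡⟨ cong ℤ→ℚ (trans (ℤP.neg-distribˡ-* ((ℤ.- (+ 1)) ℤ.^ m) (+ (m !))) (cong (ℤ._* + (m !)) (sym (ℤP.-1*i≡-i ((ℤ.- (+ 1)) ℤ.^ m))))) ⟩
    ℤ→ℚ ((ℤ.- (+ 1)) ℤ.^ suc m ℤ.* + (m !))        ∎))
    where
    open ≡-Reasoning
    p = proj₁ (rising-positive a m)
    rising≡1+p = proj₂ (rising-positive a m)
    denominator : prodℕ (List.map (λ s → m ℕ.* (2 ℕ.+ k) ℕ.+ l ℕ.+ 1 ℕ.∸ s) (List.upTo (suc m))) ≡ suc p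
    denominator = trans (cong (λ N → prodℕ (List.map (λ s → N ℕ.∸ s) (List.upTo (suc m)))) N≡1+a+m)
                        (trans (descending≡rising a m) rising≡1+p)
      where
      N≡1+a+m : m ℕ.* (2 ℕ.+ k) ℕ.+ l ℕ.+ 1 ≡ suc (a ℕ.+ m)
      N≡1+a+m = solve 3 (λ m k l → m :* (con 2 :+ k) :+ l :+ con 1 := con 1 :+ ((l :+ (con 1 :+ k) :* m) :+ m)) refl m k l
        where open ℕ-Solver

  coeff-Q-nonzero : ¬ (coeff (Q k m l) (x₁^ (degree k m l)) ≡ 0ℚ)
  coeff-Q-nonzero coeff≡0 = nonzero a m (ℚP.neg-injective (trans (sym coeff-Q) coeff≡0))

  Q-nonzero : ¬ (Q k m l ≈ 0P)
  Q-nonzero Q≈0 = coeff-Q-nonzero (Q≈0 (x₁^ (degree k m l)))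

  degree-x₁ : DegreeIn fzero (degree k m l) (Q k m l)
              × coeffIn fzero (degree k m l) (Q k m l) ≈ const (leadCoeff₁ (2 ℕ.+ k) m l)
  degree-x₁ = exact-degree coeff-Q-nonzero
            , λ e → trans (top-coefficient e) (cong (λ c → coeff (const c) e) (trans coeff-Q (sym leading)))
    where open Homogeneous (homogeneous-Q k m l) fzero

  Qexcept-nonzero : (j : Fin k) → ¬ (Qexcept k m l (fsuc (fsuc j)) ≈ 0P)
  Qexcept-nonzero j Q′≈0 = nonzero _ m (ℚP.neg-injective (trans (sym (coeff-x₁^ J′ J′∌x₁))
    (trans (cong (λ J → coeff (integral i₁ i₂ (integrand l m J)) E) (sym (without-other x fzero rest (λ ())))) (Q′≈0 E))))
    where
    x = fsuc (fsuc j)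
    J′ = without x rest
    J′∌x₁ : All (λ j → ¬ (j ≡ fzero)) J′
    J′∌x₁ = All.filter⁺ (λ y → T? (not (does (y ≟F x)))) rest∌x₁
    E = x₁^ (suc (l ℕ.+ List.length (fzero ∷ J′) ℕ.* m))

proposition3 : (k m l : ℕ) →
    let n = 2 + k in
    let D = n * m + l + 1 in
    IsHomogeneousOfDegree D (Q k m l)
    × ((σ : Permutation′ n) → σ ⟨$⟩ʳ zero ≡ zero → σ ⟨$⟩ʳ suc zero ≡ suc zero →
         rename σ (Q k m l) ≈ Q k m l)
    × rename (transpose zero (suc zero)) (Q k m l) ≈ -P Q k m l
    × (DegreeIn zero D (Q k m l)
       × coeffIn zero D (Q k m l) ≈ const (leadCoeff₁ n m l))
    × ((j : Fin k) →
         DegreeIn (suc (suc j)) m (Q k m l)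
         × coeffIn (suc (suc j)) m (Q k m l)
             ≈ const (ℤ→ℚ ((- (+ 1)) ^ m)) *P Qexcept k m l (suc (suc j)))
proposition3 k m l =
    (Q-nonzero , HasWeight⇒homogeneous (homogeneous-Q k m l))
  , Q-symmetric k m l
  , Q-antisymmetric k m l
  , degree-x₁
  , λ j → let open OtherVariable k m l j in
          (top-nonzero (Qexcept-nonzero j) , above-degree) , top-coefficient
  where open FirstVariable k m l
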